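{- Let $\sigma,\hat{\sigma}\in\mathfrak{S}_j$ satisfy $\mathrm{ides}(\sigma)=\mathrm{ides}(\hat{\sigma})$, and let $\tau,\hat{\tau}\in\mathfrak{S}_k$ satisfy $\mathrm{ides}(\tau)=\mathrm{ides}(\hat{\tau})$. Then \[ \sum_{\mu \in \sigma \vartriangle \tau}t^{\mathrm{ides}(\mu)} =\sum_{\mu \in \hat{\sigma} \triangledown \hat{\tau}}t^{\mathrm{ides}(\mu)}. \]
   Context: $\mathfrak{S}_n$ is the set of permutations of $[n]$ written as words; $\mathrm{ides}(\mu)=\mathrm{des}(\mu^{ -1})$, where $\mathrm{des}$ counts indices $i$ with $\mu_i>\mu_{i+1}$. For a word $\sigma'$ of $j$ distinct integers, $\sigma'\sim\sigma$ means that replacing its letters order-preservingly by $1,\dots,j$ gives $\sigma$. For $\sigma\in\mathfrak{S}_j,\tau\in\mathfrak{S}_k$: $\sigma \vartriangle \tau =\{ \mu = \sigma'1\tau' \in \mathfrak{S}_{j+k+1} : \sigma' \sim \sigma,\ \tau' \sim \tau,\ j+k+1 \text{ is a letter of } \tau' \}$ and $\sigma \triangledown \tau=\{ \mu = \sigma'1\tau' \in \mathfrak{S}_{j+k+1} : \sigma' \sim \sigma,\ \tau' \sim \tau,\ 2 \text{ is a letter of } \tau' \}$. -}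

module Defs where

open import Data.Nat using (ℕ; zero; suc; _+_; _<_; _<ᵇ_; _≡ᵇ_)
open import Data.Bool using (Bool; true; false; if_then_else_)
open import Data.List using (List; []; _∷_; _++_; [_]; map; upTo; length)
open import Data.List.Membership.Propositional using (_∈_)
open import Data.List.Relation.Binary.Permutation.Propositional using (_↭_)
open import Data.Product using (_×_; Σ; ∃; ∃-syntax)
open import Relation.Binary.PropositionalEquality using (_≡_)
open import Function.Bundles using (_⇔_)

range1 : ℕ → List ℕ
range1 n = map suc (upTo n)

IsPerm : ℕ → List ℕ → Set
IsPerm n μ = μ ↭ range1 n

-- 0-based letter access (default 0 outside the word).
at : List ℕ → ℕ → ℕ
at [] _ = 0
at (x ∷ xs) zero = x
at (x ∷ xs) (suc i) = at xs i

des : List ℕ → ℕ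
des [] = 0
des (x ∷ []) = 0
des (x ∷ y ∷ r) = (if y <ᵇ x then 1 else 0) + des (y ∷ r)

-- 0-based position of the letter v in the word (length if absent)
indexOf : ℕ → List ℕ → ℕ
indexOf v [] = 0
indexOf v (x ∷ xs) = if v ≡ᵇ x then 0 else suc (indexOf v xs)

inverse : List ℕ → List ℕ
inverse μ = map (λ v → suc (indexOf v μ)) (range1 (length μ))

ides : List ℕ → ℕ
ides μ = des (inverse μ)

-- σ' ∼ σ : σ' is order-isomorphic to σ (standardizing σ' gives σ)
_∼_ : List ℕ → List ℕ → Set
σ' ∼ σ = (length σ' ≡ length σ) ×
         (∀ a b → a < length σ' → b < length σ' →
            (at σ' a < at σ' b) ⇔ (at σ a < at σ b))

-- μ ∈ σ △ τ  (σ ∈ 𝔖_j, τ ∈ 𝔖_k)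
InUp : ℕ → ℕ → List ℕ → List ℕ → List ℕ → Set
InUp j k σ τ μ =
  IsPerm (j + k + 1) μ ×
  ∃[ σ' ] ∃[ τ' ] ((μ ≡ σ' ++ [ 1 ] ++ τ') × (σ' ∼ σ) × (τ' ∼ τ) × ((j + k + 1) ∈ τ'))

-- μ ∈ σ ▽ τ
InDown : ℕ → ℕ → List ℕ → List ℕ → List ℕ → Set
InDown j k σ τ μ =
  IsPerm (j + k + 1) μ ×
  ∃[ σ' ] ∃[ τ' ] ((μ ≡ σ' ++ [ 1 ] ++ τ') × (σ' ∼ σ) × (τ' ∼ τ) × (2 ∈ τ'))

-- Write μ = σ′ 1 τ′ and colour the values 2, …, n by whether they lie in σ′ (true) or in τ′ (false).
-- Then μ⁻¹ is j + 1 followed by the shuffle, along this colour word, of σ⁻¹ and of τ⁻¹ shifted by j + 1.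
-- So μ ↦ colour word is a bijection from σ △ τ (σ ▽ τ) onto the words with j letters true and k letters
-- false whose last (first) letter is false, and ides μ is read off from the colour word and the descent
-- words of σ⁻¹ and τ⁻¹.  Exchanging two adjacent entries of one descent word is compensated by an
-- involution on colour words, so the sums depend on σ and τ only through ides σ and ides τ.  Both sums
-- then reduce to the same sum over all words with j letters true and k - 1 letters false: for σ ▽ τ by
-- deleting the first letter, for σ △ τ by deleting the last one once the leading entry of the descent
-- word of τ⁻¹ has been moved to its end.
module Submission where

open import Defs
open import Data.Bool using (Bool; true; false; not; if_then_else_; T)
open import Data.Bool.Properties using (not-involutive; not-injective; T-≡; T-not-≡; T?) renaming (_≟_ to _≟ᵇ_)
open import Data.Empty using (⊥; ⊥-elim)
open import Data.List using (List; []; _∷_; [_]; _++_; _∷ʳ_; map; length; replicate; filter; filterᵇ; head; take; applyUpTo)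
open import Data.List.Properties using (map-id; map-∘; map-cong; map-cong-local; length-map; length-replicate; length-++; ∷-injectiveˡ; ∷-injectiveʳ; ∷ʳ-injectiveˡ)
open import Data.List.Membership.Propositional using (_∈_; _∉_)
open import Data.List.Membership.Propositional.Properties using (∈-map⁺; ∈-map⁻; ∈-++⁺ˡ; ∈-++⁺ʳ; ∈-++⁻; ∈-filter⁺; ∈-filter⁻)
open import Data.List.Membership.Propositional.Properties.WithK using (unique∧set⇒bag)
open import Data.List.Relation.Binary.BagAndSetEquality using (∼bag⇒↭)
open import Data.List.Relation.Binary.Permutation.Propositional using (_↭_; ↭-sym; ↭⇒↭ₛ)
import Data.List.Relation.Binary.Permutation.Setoid.Properties as ↭ₛ
import Data.List.Relation.Binary.Permutation.Propositional.Properties as ↭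
open import Data.List.Relation.Unary.All as All using (All; []; _∷_)
import Data.List.Relation.Unary.All.Properties as AllP
open import Data.List.Relation.Unary.Any as Any using (here; there)
open import Data.List.Relation.Unary.Unique.Propositional using (Unique; []; _∷_)
import Data.List.Relation.Unary.Unique.Propositional.Properties as Unique
open import Data.Maybe using (just)
import Data.Maybe.Properties as Maybe
open import Data.Nat using (ℕ; zero; suc; _+_; _∸_; _^_; _<_; _≤_; z≤n; s≤s; _<ᵇ_; _≡ᵇ_) renaming (_≟_ to _≟ℕ_)
open import Data.Nat.Properties
open import Data.Nat.ListAction using (sum)
open import Data.Nat.ListAction.Properties using (sum-↭)
open import Data.Product using (_×_; _,_; proj₁; proj₂; ∃-syntax)
open import Data.Sum using (_⊎_; inj₁; inj₂)
open import Function using (_∘_)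
open import Function.Bundles using (_⇔_; mk⇔; Equivalence)
open import Relation.Nullary using (¬_; yes; no)
open import Relation.Nullary.Decidable using (_×-dec_)
open import Relation.Unary using (Decidable)
open import Relation.Binary.Definitions using (tri<; tri≈; tri>)
open import Relation.Binary.PropositionalEquality hiding ([_])

unique∧set⇒↭ : {A : Set} {xs ys : List A} → Unique xs → Unique ys → (∀ z → z ∈ xs ⇔ z ∈ ys) → xs ↭ ys
unique∧set⇒↭ ux uy h = ∼bag⇒↭ (unique∧set⇒bag ux uy (λ {z} → h z))

sum-map-cong-∈ : {A : Set} (xs : List A) {f g : A → ℕ} → (∀ {x} → x ∈ xs → f x ≡ g x) →
                 sum (map f xs) ≡ sum (map g xs)
sum-map-cong-∈ xs f≗g = cong sum (map-cong-local (All.tabulate f≗g))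

sum-map-↭ : {A : Set} {xs ys : List A} (f : A → ℕ) → xs ↭ ys → sum (map f xs) ≡ sum (map f ys)
sum-map-↭ f xs↭ys = sum-↭ (↭.map⁺ f xs↭ys)

sum-map-∘-↭ : {A B : Set} {xs : List A} {ys : List B} (f : B → ℕ) (g : A → B) →
              map g xs ↭ ys → sum (map (f ∘ g) xs) ≡ sum (map f ys)
sum-map-∘-↭ {xs = xs} f g gxs↭ys = trans (cong sum (map-∘ xs)) (sum-map-↭ f gxs↭ys)

sum-map-↭-map : {A B : Set} {xs : List A} {ys : List B} (f : A → ℕ) (g : B → A) →
                xs ↭ map g ys → sum (map f xs) ≡ sum (map (f ∘ g) ys)
sum-map-↭-map {ys = ys} f g xs↭gys = trans (sum-map-↭ f xs↭gys) (sym (cong sum (map-∘ ys)))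

sum-map-involution : {A : Set} {xs : List A} (f : A → ℕ) (φ : A → A) → Unique xs →
                     (∀ x → φ (φ x) ≡ x) → (∀ {x} → x ∈ xs → φ x ∈ xs) →
                     sum (map (f ∘ φ) xs) ≡ sum (map f xs)
sum-map-involution {xs = xs} f φ uxs φ-inv φ-closed =
  sum-map-∘-↭ f φ (unique∧set⇒↭ (Unique.map⁺ φ-injective uxs) uxs same-members)
  where
  φ-injective : ∀ {x y} → φ x ≡ φ y → x ≡ y
  φ-injective {x} {y} e = trans (sym (φ-inv x)) (trans (cong φ e) (φ-inv y))
  same-members : ∀ z → z ∈ map φ xs ⇔ z ∈ xs
  same-members z = mk⇔ to (λ z∈ → subst (_∈ map φ xs) (φ-inv z) (∈-map⁺ φ (φ-closed z∈)))
    where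
    to : z ∈ map φ xs → z ∈ xs
    to z∈ with ∈-map⁻ φ z∈
    ... | x , x∈ , refl = φ-closed x∈

-- Words of letters true and false

bit : Bool → ℕ
bit b = if b then 1 else 0

#true #false : List Bool → ℕ
#true [] = 0
#true (b ∷ w) = bit b + #true w
#false [] = 0
#false (b ∷ w) = bit (not b) + #false w

#true+#false≡length : ∀ w → #true w + #false w ≡ length w
#true+#false≡length [] = refl
#true+#false≡length (true ∷ w) = cong suc (#true+#false≡length w)
#true+#false≡length (false ∷ w) = trans (+-suc (#true w) (#false w)) (cong suc (#true+#false≡length w))

#true-map-not : ∀ w → #true (map not w) ≡ #false w
#true-map-not [] = refl
#true-map-not (b ∷ w) = cong (bit (not b) +_) (#true-map-not w)

#false-map-not : ∀ w → #false (map not w) ≡ #true w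
#false-map-not [] = refl
#false-map-not (b ∷ w) = cong₂ _+_ (cong bit (not-involutive b)) (#false-map-not w)

words : ℕ → List (List Bool)
words zero = [ [] ]
words (suc n) = map (true ∷_) (words n) ++ map (false ∷_) (words n)

∈-words : ∀ w → w ∈ words (length w)
∈-words [] = here refl
∈-words (true ∷ w) = ∈-++⁺ˡ (∈-map⁺ (true ∷_) (∈-words w))
∈-words (false ∷ w) = ∈-++⁺ʳ _ (∈-map⁺ (false ∷_) (∈-words w))

words-unique : ∀ n → Unique (words n)
words-unique zero = [] ∷ []
words-unique (suc n) = Unique.++⁺ (Unique.map⁺ ∷-injectiveʳ (words-unique n))
                                  (Unique.map⁺ ∷-injectiveʳ (words-unique n)) heads-differ
  where
  heads-differ : ∀ {v} → v ∈ map (true ∷_) (words n) × v ∈ map (false ∷_) (words n) → ⊥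
  heads-differ (v∈ , v∈′) with ∈-map⁻ (true ∷_) v∈ | ∈-map⁻ (false ∷_) v∈′
  ... | _ , _ , refl | _ , _ , ()

HasCounts : ℕ → ℕ → List Bool → Set
HasCounts j k w = #true w ≡ j × #false w ≡ k

hasCounts? : ∀ j k → Decidable (HasCounts j k)
hasCounts? j k w = (#true w ≟ℕ j) ×-dec (#false w ≟ℕ k)

opaque
  shuffles : ℕ → ℕ → List (List Bool)
  shuffles j k = filter (hasCounts? j k) (words (j + k))

  shuffles-unique : ∀ j k → Unique (shuffles j k)
  shuffles-unique j k = Unique.filter⁺ (hasCounts? j k) {words (j + k)} (words-unique (j + k))

  ∈-shuffles⁺ : ∀ {j k w} → #true w ≡ j → #false w ≡ k → w ∈ shuffles j k
  ∈-shuffles⁺ {j} {k} {w} refl refl =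
    ∈-filter⁺ (hasCounts? j k) (subst (λ n → w ∈ words n) (sym (#true+#false≡length w)) (∈-words w)) (refl , refl)

  ∈-shuffles⁻ : ∀ {j k w} → w ∈ shuffles j k → HasCounts j k w
  ∈-shuffles⁻ {j} {k} w∈ = proj₂ (∈-filter⁻ (hasCounts? j k) {xs = words (j + k)} w∈)

shuffles-closed : ∀ {j k w} (φ : List Bool → List Bool) → (∀ w → #true (φ w) ≡ #true w) →
                  (∀ w → #false (φ w) ≡ #false w) → w ∈ shuffles j k → φ w ∈ shuffles j k
shuffles-closed {w = w} φ #true-φ #false-φ w∈ with ∈-shuffles⁻ w∈
... | #true≡ , #false≡ = ∈-shuffles⁺ (trans (#true-φ w) #true≡) (trans (#false-φ w) #false≡)

-- Descents of shuffles

hd : List Bool → ℕ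
hd [] = 0
hd (d ∷ _) = bit d

tl : List Bool → List Bool
tl [] = []
tl (_ ∷ D) = D

-- Descents of a shuffle of two sequences, the first lying entirely below the second.  The letter
-- true (false) of w takes the next entry of the lower (upper) sequence, whose descent word is D (E):
-- entry i of D tells whether element i of the lower sequence is smaller than element i - 1.  The
-- letter p is the one read last; a step from the upper to the lower sequence counts a, back counts b.
shuffleDes : ℕ → ℕ → Bool → List Bool → List Bool → List Bool → ℕ
shuffleDes a b p [] D E = 0
shuffleDes a b p (true ∷ w) D E = (if p then hd D else a) + shuffleDes a b true w (tl D) E
shuffleDes a b p (false ∷ w) D E = (if p then b else hd E) + shuffleDes a b false w D (tl E)

shuffleDes-map-not : ∀ a b p w D E → shuffleDes a b p w D E ≡ shuffleDes b a (not p) (map not w) E D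
shuffleDes-map-not a b p [] D E = refl
shuffleDes-map-not a b true (true ∷ w) D E = cong (hd D +_) (shuffleDes-map-not a b true w (tl D) E)
shuffleDes-map-not a b false (true ∷ w) D E = cong (a +_) (shuffleDes-map-not a b true w (tl D) E)
shuffleDes-map-not a b true (false ∷ w) D E = cong (b +_) (shuffleDes-map-not a b false w D (tl E))
shuffleDes-map-not a b false (false ∷ w) D E = cong (hd E +_) (shuffleDes-map-not a b false w D (tl E))

lastOr : Bool → List Bool → Bool
lastOr d [] = d
lastOr d (x ∷ w) = lastOr x w

lastOr-map-not : ∀ d w → lastOr d (map not w) ≡ not (lastOr (not d) w)
lastOr-map-not d [] = sym (not-involutive d)
lastOr-map-not d (b ∷ w) = trans (lastOr-map-not (not b) w) (cong (λ c → not (lastOr c w)) (not-involutive b))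

-- An involution compensating an exchange of adjacent descent bits

falses : ℕ → List Bool
falses n = replicate n false

twoBlocks : ℕ → ℕ → List Bool → List Bool
twoBlocks x y r = falses x ++ true ∷ falses y ++ true ∷ r

data FirstTrue : List Bool → Set where
  none : ∀ x → FirstTrue (falses x)
  found : ∀ x r → FirstTrue (falses x ++ true ∷ r)

firstTrue : ∀ w → FirstTrue w
firstTrue [] = none 0
firstTrue (true ∷ r) = found 0 r
firstTrue (false ∷ w) with firstTrue w
... | none x = none (suc x)
... | found x r = found (suc x) r

data FirstTwoTrues : List Bool → Set where
  none : ∀ x → FirstTwoTrues (falses x)
  one : ∀ x y → FirstTwoTrues (falses x ++ true ∷ falses y)
  two : ∀ x y r → FirstTwoTrues (twoBlocks x y r)

firstTwoTrues : ∀ w → FirstTwoTrues w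
firstTwoTrues w with firstTrue w
... | none x = none x
... | found x r with firstTrue r
...   | none y = one x y
...   | found y r′ = two x y r′

leadingFalses : List Bool → ℕ × List Bool
leadingFalses [] = 0 , []
leadingFalses (true ∷ w) = 0 , true ∷ w
leadingFalses (false ∷ w) = suc (proj₁ (leadingFalses w)) , proj₂ (leadingFalses w)

leadingFalses-falses : ∀ x → leadingFalses (falses x) ≡ (x , [])
leadingFalses-falses zero = refl
leadingFalses-falses (suc x) rewrite leadingFalses-falses x = refl

leadingFalses-falses++true : ∀ x r → leadingFalses (falses x ++ true ∷ r) ≡ (x , true ∷ r)
leadingFalses-falses++true zero r = refl
leadingFalses-falses++true (suc x) r rewrite leadingFalses-falses++true x r = refl

-- The two gaps are exchanged only when exactly one of them is empty: when both are nonempty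
-- the descent bits of the two true letters do not contribute to shuffleDes at all.
exchangeGaps : ℕ → ℕ → List Bool → List Bool
exchangeGaps zero y r = twoBlocks y zero r
exchangeGaps (suc x) zero r = twoBlocks zero (suc x) r
exchangeGaps (suc x) (suc y) r = twoBlocks (suc x) (suc y) r

exchangeGaps-cases : ∀ x y r → exchangeGaps x y r ≡ twoBlocks y x r ⊎ exchangeGaps x y r ≡ twoBlocks x y r
exchangeGaps-cases zero y r = inj₁ refl
exchangeGaps-cases (suc x) zero r = inj₁ refl
exchangeGaps-cases (suc x) (suc y) r = inj₂ refl

swapGaps₂ : ℕ → ℕ × List Bool → List Bool
swapGaps₂ x (y , true ∷ r) = exchangeGaps x y r
swapGaps₂ x (y , []) = falses x ++ true ∷ falses y
swapGaps₂ x (y , r) = falses x ++ true ∷ falses y ++ r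

swapGaps₁ : ℕ × List Bool → List Bool
swapGaps₁ (x , true ∷ r) = swapGaps₂ x (leadingFalses r)
swapGaps₁ (x , []) = falses x
swapGaps₁ (x , r) = falses x ++ r

swapGaps : List Bool → List Bool
swapGaps w = swapGaps₁ (leadingFalses w)

swapGaps-none : ∀ x → swapGaps (falses x) ≡ falses x
swapGaps-none x rewrite leadingFalses-falses x = refl

swapGaps-one : ∀ x y → swapGaps (falses x ++ true ∷ falses y) ≡ falses x ++ true ∷ falses y
swapGaps-one x y rewrite leadingFalses-falses++true x (falses y) | leadingFalses-falses y = refl

swapGaps-two : ∀ x y r → swapGaps (twoBlocks x y r) ≡ exchangeGaps x y r
swapGaps-two x y r rewrite leadingFalses-falses++true x (falses y ++ true ∷ r)
                         | leadingFalses-falses++true y r = refl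

swapGaps-exchangeGaps : ∀ x y r → swapGaps (exchangeGaps x y r) ≡ twoBlocks x y r
swapGaps-exchangeGaps zero zero r = swapGaps-two zero zero r
swapGaps-exchangeGaps zero (suc y) r = swapGaps-two (suc y) zero r
swapGaps-exchangeGaps (suc x) zero r = swapGaps-two zero (suc x) r
swapGaps-exchangeGaps (suc x) (suc y) r = swapGaps-two (suc x) (suc y) r

swapGaps-involutive : ∀ w → swapGaps (swapGaps w) ≡ w
swapGaps-involutive w with firstTwoTrues w
... | none x rewrite swapGaps-none x = swapGaps-none x
... | one x y rewrite swapGaps-one x y = swapGaps-one x y
... | two x y r rewrite swapGaps-two x y r = swapGaps-exchangeGaps x y r

swapGaps-preserves : {A : Set} (f : List Bool → A) → (∀ x y r → f (twoBlocks x y r) ≡ f (twoBlocks y x r)) →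
                     ∀ w → f (swapGaps w) ≡ f w
swapGaps-preserves f f-sym w with firstTwoTrues w
... | none x = cong f (swapGaps-none x)
... | one x y = cong f (swapGaps-one x y)
... | two x y r with exchangeGaps-cases x y r
...   | inj₁ e = trans (cong f (trans (swapGaps-two x y r) e)) (f-sym y x r)
...   | inj₂ e = cong f (trans (swapGaps-two x y r) e)

#true-falses++ : ∀ x v → #true (falses x ++ v) ≡ #true v
#true-falses++ zero v = refl
#true-falses++ (suc x) v = #true-falses++ x v

#true-falses : ∀ x → #true (falses x) ≡ 0
#true-falses zero = refl
#true-falses (suc x) = #true-falses x

#false-falses++ : ∀ x v → #false (falses x ++ v) ≡ x + #false v
#false-falses++ zero v = refl
#false-falses++ (suc x) v = cong suc (#false-falses++ x v)

lastOr-falses++true : ∀ d x v → lastOr d (falses x ++ true ∷ v) ≡ lastOr true v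
lastOr-falses++true d zero v = refl
lastOr-falses++true d (suc x) v = lastOr-falses++true false x v

#true-twoBlocks : ∀ x y r → #true (twoBlocks x y r) ≡ 2 + #true r
#true-twoBlocks x y r = trans (#true-falses++ x _) (cong suc (#true-falses++ y _))

#false-twoBlocks : ∀ x y r → #false (twoBlocks x y r) ≡ (x + y) + #false r
#false-twoBlocks x y r = trans (#false-falses++ x _) (trans (cong (x +_) (#false-falses++ y _)) (sym (+-assoc x y _)))

lastOr-twoBlocks : ∀ d x y r → lastOr d (twoBlocks x y r) ≡ lastOr true r
lastOr-twoBlocks d x y r = trans (lastOr-falses++true d x _) (lastOr-falses++true true y r)

swapGaps-#true : ∀ w → #true (swapGaps w) ≡ #true w
swapGaps-#true = swapGaps-preserves #true (λ x y r → trans (#true-twoBlocks x y r) (sym (#true-twoBlocks y x r)))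

swapGaps-#false : ∀ w → #false (swapGaps w) ≡ #false w
swapGaps-#false = swapGaps-preserves #false λ x y r →
  trans (#false-twoBlocks x y r) (trans (cong (_+ #false r) (+-comm x y)) (sym (#false-twoBlocks y x r)))

swapGaps-lastOr : ∀ d w → lastOr d (swapGaps w) ≡ lastOr d w
swapGaps-lastOr d = swapGaps-preserves (lastOr d) λ x y r →
  trans (lastOr-twoBlocks d x y r) (sym (lastOr-twoBlocks d y x r))

swapGapsAfter : ℕ → List Bool → List Bool
swapGapsAfter zero w = swapGaps w
swapGapsAfter (suc i) [] = []
swapGapsAfter (suc i) (true ∷ w) = true ∷ swapGapsAfter i w
swapGapsAfter (suc i) (false ∷ w) = false ∷ swapGapsAfter (suc i) w

swapGapsAfter-involutive : ∀ i w → swapGapsAfter i (swapGapsAfter i w) ≡ w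
swapGapsAfter-involutive zero w = swapGaps-involutive w
swapGapsAfter-involutive (suc i) [] = refl
swapGapsAfter-involutive (suc i) (true ∷ w) = cong (true ∷_) (swapGapsAfter-involutive i w)
swapGapsAfter-involutive (suc i) (false ∷ w) = cong (false ∷_) (swapGapsAfter-involutive (suc i) w)

swapGapsAfter-#true : ∀ i w → #true (swapGapsAfter i w) ≡ #true w
swapGapsAfter-#true zero w = swapGaps-#true w
swapGapsAfter-#true (suc i) [] = refl
swapGapsAfter-#true (suc i) (true ∷ w) = cong suc (swapGapsAfter-#true i w)
swapGapsAfter-#true (suc i) (false ∷ w) = swapGapsAfter-#true (suc i) w

swapGapsAfter-#false : ∀ i w → #false (swapGapsAfter i w) ≡ #false w
swapGapsAfter-#false zero w = swapGaps-#false w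
swapGapsAfter-#false (suc i) [] = refl
swapGapsAfter-#false (suc i) (true ∷ w) = swapGapsAfter-#false i w
swapGapsAfter-#false (suc i) (false ∷ w) = cong suc (swapGapsAfter-#false (suc i) w)

swapGapsAfter-lastOr : ∀ i d w → lastOr d (swapGapsAfter i w) ≡ lastOr d w
swapGapsAfter-lastOr zero d w = swapGaps-lastOr d w
swapGapsAfter-lastOr (suc i) d [] = refl
swapGapsAfter-lastOr (suc i) d (true ∷ w) = swapGapsAfter-lastOr i true w
swapGapsAfter-lastOr (suc i) d (false ∷ w) = swapGapsAfter-lastOr (suc i) false w

swapGapsAfterᶠ : ℕ → List Bool → List Bool
swapGapsAfterᶠ i w = map not (swapGapsAfter i (map not w))

map-not-involutive : ∀ w → map not (map not w) ≡ w
map-not-involutive w = trans (sym (map-∘ w)) (trans (map-cong not-involutive w) (map-id w))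

swapGapsAfterᶠ-involutive : ∀ i w → swapGapsAfterᶠ i (swapGapsAfterᶠ i w) ≡ w
swapGapsAfterᶠ-involutive i w rewrite map-not-involutive (swapGapsAfter i (map not w))
                                    | swapGapsAfter-involutive i (map not w) = map-not-involutive w

swapGapsAfterᶠ-#true : ∀ i w → #true (swapGapsAfterᶠ i w) ≡ #true w
swapGapsAfterᶠ-#true i w =
  trans (#true-map-not (swapGapsAfter i (map not w))) (trans (swapGapsAfter-#false i (map not w)) (#false-map-not w))

swapGapsAfterᶠ-#false : ∀ i w → #false (swapGapsAfterᶠ i w) ≡ #false w
swapGapsAfterᶠ-#false i w =
  trans (#false-map-not (swapGapsAfter i (map not w))) (trans (swapGapsAfter-#true i (map not w)) (#true-map-not w))

swapGapsAfterᶠ-lastOr : ∀ i d w → lastOr d (swapGapsAfterᶠ i w) ≡ lastOr d w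
swapGapsAfterᶠ-lastOr i d w = begin
  lastOr d (map not (swapGapsAfter i (map not w)))  ≡⟨ lastOr-map-not d (swapGapsAfter i (map not w)) ⟩
  not (lastOr (not d) (swapGapsAfter i (map not w))) ≡⟨ cong not (swapGapsAfter-lastOr i (not d) (map not w)) ⟩
  not (lastOr (not d) (map not w))                   ≡⟨ cong not (lastOr-map-not (not d) w) ⟩
  not (not (lastOr (not (not d)) w))                 ≡⟨ not-involutive _ ⟩
  lastOr (not (not d)) w                             ≡⟨ cong (λ c → lastOr c w) (not-involutive d) ⟩
  lastOr d w                                         ∎
  where open ≡-Reasoning

hdSum : ℕ → List Bool → ℕ
hdSum zero E = 0
hdSum (suc x) E = hd E + hdSum x (tl E)

tlⁿ : ℕ → List Bool → List Bool
tlⁿ zero E = E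
tlⁿ (suc x) E = tlⁿ x (tl E)

+-reassoc : ∀ a b c d → a + ((b + c) + d) ≡ ((a + b) + c) + d
+-reassoc a b c d = trans (sym (+-assoc a (b + c) d)) (cong (_+ d) (sym (+-assoc a b c)))

module _ (a b : ℕ) where

  -- What a block of x letters false and then a letter true with descent bit d contributes after a
  -- letter true; it ignores d unless x = 0.
  gapDes : ℕ → Bool → List Bool → ℕ
  gapDes zero d E = bit d
  gapDes (suc x) d E = b + hdSum x (tl E) + a

  shuffleDes-false-gap : ∀ x r d D E →
    shuffleDes a b false (falses x ++ true ∷ r) (d ∷ D) E ≡ hdSum x E + a + shuffleDes a b true r D (tlⁿ x E)
  shuffleDes-false-gap zero r d D E = refl
  shuffleDes-false-gap (suc x) r d D E =
    trans (cong (hd E +_) (shuffleDes-false-gap x r d D (tl E))) (+-reassoc (hd E) (hdSum x (tl E)) a _)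

  shuffleDes-gap : ∀ x r d D E →
    shuffleDes a b true (falses x ++ true ∷ r) (d ∷ D) E ≡ gapDes x d E + shuffleDes a b true r D (tlⁿ x E)
  shuffleDes-gap zero r d D E = refl
  shuffleDes-gap (suc x) r d D E =
    trans (cong (b +_) (shuffleDes-false-gap x r d D (tl E))) (+-reassoc b (hdSum x (tl E)) a _)

  shuffleDes-twoBlocks : ∀ x y r d₁ d₂ D E →
    shuffleDes a b true (twoBlocks x y r) (d₁ ∷ d₂ ∷ D) E ≡
    gapDes x d₁ E + (gapDes y d₂ (tlⁿ x E) + shuffleDes a b true r D (tlⁿ y (tlⁿ x E)))
  shuffleDes-twoBlocks x y r d₁ d₂ D E =
    trans (shuffleDes-gap x (falses y ++ true ∷ r) d₁ (d₂ ∷ D) E)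
          (cong (gapDes x d₁ E +_) (shuffleDes-gap y r d₂ D (tlⁿ x E)))

  shuffleDes-exchangeGaps : ∀ x y r D E →
    shuffleDes a b true (twoBlocks x y r) (true ∷ false ∷ D) E ≡
    shuffleDes a b true (exchangeGaps x y r) (false ∷ true ∷ D) E
  shuffleDes-exchangeGaps zero zero r D E = refl
  shuffleDes-exchangeGaps zero (suc y) r D E =
    trans (shuffleDes-twoBlocks zero (suc y) r true false D E)
          (trans (sym (+-suc (gapDes (suc y) false E) _))
                 (sym (shuffleDes-twoBlocks (suc y) zero r false true D E)))
  shuffleDes-exchangeGaps (suc x) zero r D E =
    trans (shuffleDes-twoBlocks (suc x) zero r true false D E)
          (sym (shuffleDes-twoBlocks zero (suc x) r false true D E))
  shuffleDes-exchangeGaps (suc x) (suc y) r D E =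
    trans (shuffleDes-twoBlocks (suc x) (suc y) r true false D E)
          (sym (shuffleDes-twoBlocks (suc x) (suc y) r false true D E))

  shuffleDes-swapGaps : ∀ w D E → 2 ≤ #true w →
    shuffleDes a b true w (true ∷ false ∷ D) E ≡ shuffleDes a b true (swapGaps w) (false ∷ true ∷ D) E
  shuffleDes-swapGaps w D E 2≤ with firstTwoTrues w
  ... | none x with () ← subst (2 ≤_) (#true-falses x) 2≤
  ... | one x y with s≤s () ← subst (2 ≤_) (trans (#true-falses++ x (true ∷ falses y)) (cong suc (#true-falses y))) 2≤
  ... | two x y r rewrite swapGaps-two x y r = shuffleDes-exchangeGaps x y r D E

  -- For i = 0 the letter before w must be true: after a letter false the descent bit of the first
  -- letter true is not read.
  shuffleDes-swapGapsAfter : ∀ p X Y E w → (X ≡ [] → p ≡ true) → length X + 2 ≤ #true w →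
    shuffleDes a b p w (X ++ true ∷ false ∷ Y) E ≡
    shuffleDes a b p (swapGapsAfter (length X) w) (X ++ false ∷ true ∷ Y) E
  shuffleDes-swapGapsAfter p [] Y E w p≡true 2≤ rewrite p≡true refl = shuffleDes-swapGaps w Y E 2≤
  shuffleDes-swapGapsAfter p (x ∷ X) Y E (true ∷ w) _ (s≤s ≤#true) =
    cong ((if p then bit x else a) +_) (shuffleDes-swapGapsAfter true X Y E w (λ _ → refl) ≤#true)
  shuffleDes-swapGapsAfter p (x ∷ X) Y E (false ∷ w) _ ≤#true =
    cong ((if p then b else hd E) +_) (shuffleDes-swapGapsAfter false (x ∷ X) Y (tl E) w (λ ()) ≤#true)

shuffleDes-swapGapsAfterᶠ : ∀ a b X Y D w → length X + 2 ≤ #false w →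
  shuffleDes a b false w D (X ++ true ∷ false ∷ Y) ≡
  shuffleDes a b false (swapGapsAfterᶠ (length X) w) D (X ++ false ∷ true ∷ Y)
shuffleDes-swapGapsAfterᶠ a b X Y D w ≤#false = begin
  shuffleDes a b false w D (X ++ true ∷ false ∷ Y)
    ≡⟨ shuffleDes-map-not a b false w D _ ⟩
  shuffleDes b a true (map not w) (X ++ true ∷ false ∷ Y) D
    ≡⟨ shuffleDes-swapGapsAfter b a true X Y D (map not w) (λ _ → refl) (subst (length X + 2 ≤_) (sym (#true-map-not w)) ≤#false) ⟩
  shuffleDes b a true (swapGapsAfter (length X) (map not w)) (X ++ false ∷ true ∷ Y) D
    ≡⟨ cong (λ v → shuffleDes b a true v (X ++ false ∷ true ∷ Y) D) (sym (map-not-involutive (swapGapsAfter (length X) (map not w)))) ⟩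
  shuffleDes b a true (map not (swapGapsAfterᶠ (length X) w)) (X ++ false ∷ true ∷ Y) D
    ≡⟨ shuffleDes-map-not a b false (swapGapsAfterᶠ (length X) w) D _ ⟨
  shuffleDes a b false (swapGapsAfterᶠ (length X) w) D (X ++ false ∷ true ∷ Y) ∎
  where open ≡-Reasoning

-- Sums of descent statistics

SwapInvariant : ℕ → (List Bool → ℕ) → Set
SwapInvariant n F = ∀ X Y → length X + 2 ≤ n → F (X ++ true ∷ false ∷ Y) ≡ F (X ++ false ∷ true ∷ Y)

SwapInvariant-∷ : ∀ {n} F d → SwapInvariant (suc n) F → SwapInvariant n (F ∘ (d ∷_))
SwapInvariant-∷ F d inv X Y ℓ = inv (d ∷ X) Y (s≤s ℓ)

sortedBits : List Bool → List Bool
sortedBits D = replicate (#true D) true ++ replicate (#false D) false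

swapInvariant-bubble : ∀ {n F} → SwapInvariant n F → ∀ m Z → suc (m + length Z) ≤ n →
  F (false ∷ replicate m true ++ Z) ≡ F (replicate m true ++ false ∷ Z)
swapInvariant-bubble inv zero Z _ = refl
swapInvariant-bubble {suc n} {F} inv (suc m) Z (s≤s le) =
  trans (sym (inv [] (replicate m true ++ Z) (s≤s (≤-trans (s≤s z≤n) le))))
        (swapInvariant-bubble {F = F ∘ (true ∷_)} (SwapInvariant-∷ F true inv) m Z le)

swapInvariant-sortedBits : ∀ {n F} → SwapInvariant n F → ∀ D → length D ≤ n → F D ≡ F (sortedBits D)
swapInvariant-sortedBits inv [] _ = refl
swapInvariant-sortedBits {suc n} {F} inv (d ∷ D) (s≤s le) =
  trans (swapInvariant-sortedBits {F = F ∘ (d ∷_)} (SwapInvariant-∷ F d inv) D le) (insert d)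
  where
  insert : ∀ d → F (d ∷ sortedBits D) ≡ F (sortedBits (d ∷ D))
  insert true = refl
  insert false = swapInvariant-bubble {F = F} inv (#true D) (replicate (#false D) false) (s≤s (begin
    #true D + length (replicate (#false D) false) ≡⟨ cong (#true D +_) (length-replicate (#false D)) ⟩
    #true D + #false D                            ≡⟨ #true+#false≡length D ⟩
    length D                                      ≤⟨ le ⟩
    n                                             ∎))
    where open ≤-Reasoning

swapInvariant-#true : ∀ {n} (F : List Bool → ℕ) → SwapInvariant n F → ∀ D₁ D₂ → length D₁ ≡ n → length D₂ ≡ n →
                      #true D₁ ≡ #true D₂ → F D₁ ≡ F D₂
swapInvariant-#true F inv D₁ D₂ refl ℓ₂ #true≡ = begin
  F D₁             ≡⟨ swapInvariant-sortedBits inv D₁ ≤-refl ⟩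
  F (sortedBits D₁) ≡⟨ cong₂ (λ m m′ → F (replicate m true ++ replicate m′ false)) #true≡ #false≡ ⟩
  F (sortedBits D₂) ≡⟨ swapInvariant-sortedBits inv D₂ (≤-reflexive ℓ₂) ⟨
  F D₂             ∎
  where
  open ≡-Reasoning
  #false≡ : #false D₁ ≡ #false D₂
  #false≡ = +-cancelˡ-≡ (#true D₁) (#false D₁) (#false D₂) (begin
    #true D₁ + #false D₁ ≡⟨ #true+#false≡length D₁ ⟩
    length D₁            ≡⟨ ℓ₂ ⟨
    length D₂            ≡⟨ #true+#false≡length D₂ ⟨
    #true D₂ + #false D₂ ≡⟨ cong (_+ #false D₂) #true≡ ⟨
    #true D₁ + #false D₂ ∎)

startsWithFalse? : Decidable (λ w → head w ≡ just false)
startsWithFalse? w = Maybe.≡-dec _≟ᵇ_ (head w) (just false)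

endsWithFalse? : Decidable (λ w → lastOr true w ≡ false)
endsWithFalse? w = lastOr true w ≟ᵇ false

filter-shuffles-↭ : ∀ {P : List Bool → Set} (P? : Decidable P) (ext : List Bool → List Bool) {j k} →
  (∀ {u v} → ext u ≡ ext v → u ≡ v) → (∀ u → #true (ext u) ≡ #true u) → (∀ u → #false (ext u) ≡ suc (#false u)) →
  (∀ u → P (ext u)) → (∀ {w} → P w → ∃[ u ] w ≡ ext u) →
  filter P? (shuffles j (suc k)) ↭ map ext (shuffles j k)
filter-shuffles-↭ P? ext {j} {k} ext-injective #true-ext #false-ext P-ext P⇒ext =
  unique∧set⇒↭ (Unique.filter⁺ P? {shuffles j (suc k)} (shuffles-unique j (suc k)))
               (Unique.map⁺ ext-injective (shuffles-unique j k)) same-members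
  where
  same-members : ∀ w → w ∈ filter P? (shuffles j (suc k)) ⇔ w ∈ map ext (shuffles j k)
  same-members w = mk⇔ to from
    where
    to : w ∈ filter P? (shuffles j (suc k)) → w ∈ map ext (shuffles j k)
    to w∈ with ∈-filter⁻ P? {xs = shuffles j (suc k)} w∈
    ... | w∈shuffles , Pw with P⇒ext Pw | ∈-shuffles⁻ w∈shuffles
    ...   | u , refl | #true≡ , #false≡ =
      ∈-map⁺ ext (∈-shuffles⁺ (trans (sym (#true-ext u)) #true≡) (suc-injective (trans (sym (#false-ext u)) #false≡)))
    from : w ∈ map ext (shuffles j k) → w ∈ filter P? (shuffles j (suc k))
    from w∈ with ∈-map⁻ ext w∈
    ... | u , u∈ , refl with ∈-shuffles⁻ u∈
    ...   | #true≡ , #false≡ =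
      ∈-filter⁺ P? (∈-shuffles⁺ (trans (#true-ext u) #true≡) (trans (#false-ext u) (cong suc #false≡))) (P-ext u)

#true-∷ʳ-false : ∀ u → #true (u ∷ʳ false) ≡ #true u
#true-∷ʳ-false [] = refl
#true-∷ʳ-false (b ∷ u) = cong (bit b +_) (#true-∷ʳ-false u)

#false-∷ʳ-false : ∀ u → #false (u ∷ʳ false) ≡ suc (#false u)
#false-∷ʳ-false [] = refl
#false-∷ʳ-false (b ∷ u) = trans (cong (bit (not b) +_) (#false-∷ʳ-false u)) (+-suc (bit (not b)) (#false u))

lastOr-∷ʳ : ∀ d u b → lastOr d (u ∷ʳ b) ≡ b
lastOr-∷ʳ d [] b = refl
lastOr-∷ʳ d (x ∷ u) b = lastOr-∷ʳ x u b

lastOr≡false⇒∷ʳ : ∀ x w → lastOr x w ≡ false → ∃[ u ] x ∷ w ≡ u ∷ʳ false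
lastOr≡false⇒∷ʳ x [] refl = [] , refl
lastOr≡false⇒∷ʳ x (y ∷ w) last≡false with lastOr≡false⇒∷ʳ y w last≡false
... | u , eq = x ∷ u , cong (x ∷_) eq

shuffleDes-∷ʳ-false : ∀ a p u D E → length E ≡ #false u →
                      shuffleDes a 0 p (u ∷ʳ false) D (E ∷ʳ false) ≡ shuffleDes a 0 p u D E
shuffleDes-∷ʳ-false a true [] D [] _ = refl
shuffleDes-∷ʳ-false a false [] D [] _ = refl
shuffleDes-∷ʳ-false a p (true ∷ u) D E ℓ = cong ((if p then hd D else a) +_) (shuffleDes-∷ʳ-false a true u (tl D) E ℓ)
shuffleDes-∷ʳ-false a p (false ∷ u) D (e ∷ E) ℓ =
  cong ((if p then 0 else bit e) +_) (shuffleDes-∷ʳ-false a false u D E (suc-injective ℓ))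

module _ (t : ℕ) where

  weight : List Bool → List Bool → List Bool → ℕ
  weight D E w = t ^ shuffleDes 1 0 false w D E

  desSum : List (List Bool) → List Bool → List Bool → ℕ
  desSum L D E = sum (map (weight D E) L)

  desSum-involution : ∀ {L} D E D′ E′ (φ : List Bool → List Bool) → Unique L → (∀ w → φ (φ w) ≡ w) →
    (∀ {w} → w ∈ L → φ w ∈ L) → (∀ {w} → w ∈ L → shuffleDes 1 0 false w D E ≡ shuffleDes 1 0 false (φ w) D′ E′) →
    desSum L D E ≡ desSum L D′ E′
  desSum-involution {L} D E D′ E′ φ uL φ-inv φ-closed des≡ =
    trans (sum-map-cong-∈ L (cong (t ^_) ∘ des≡))
          (sum-map-involution (weight D′ E′) φ uL φ-inv φ-closed)

  desSum-swapLower : ∀ {L j} E → Unique L → (∀ i {w} → w ∈ L → swapGapsAfter i w ∈ L) →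
    (∀ {w} → w ∈ L → #true w ≡ j) → SwapInvariant (j ∸ 1) (λ D → desSum L (false ∷ D) E)
  desSum-swapLower {j = j} E uL closed #true≡ X Y ℓ =
    desSum-involution _ E _ E (swapGapsAfter i) uL (swapGapsAfter-involutive i) (closed i) λ {w} w∈ →
      shuffleDes-swapGapsAfter 1 0 false (false ∷ X) Y E w (λ ()) (subst (i + 2 ≤_) (sym (#true≡ w∈)) (bound j ℓ))
    where
    i = suc (length X)
    bound : ∀ j → length X + 2 ≤ j ∸ 1 → i + 2 ≤ j
    bound zero ℓ with () ← ≤-trans (m≤n+m 2 (length X)) ℓ
    bound (suc j) ℓ = s≤s ℓ

  desSum-swapUpper : ∀ {L k} D → Unique L → (∀ i {w} → w ∈ L → swapGapsAfterᶠ i w ∈ L) →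
    (∀ {w} → w ∈ L → #false w ≡ k) → SwapInvariant k (desSum L D)
  desSum-swapUpper D uL closed #false≡ X Y ℓ =
    desSum-involution D _ D _ (swapGapsAfterᶠ (length X)) uL (swapGapsAfterᶠ-involutive (length X)) (closed (length X))
      λ w∈ → shuffleDes-swapGapsAfterᶠ 1 0 X Y D _ (subst (length X + 2 ≤_) (sym (#false≡ w∈)) ℓ)

  desSum-startsWithFalse : ∀ j k D E →
    desSum (filter startsWithFalse? (shuffles j (suc k))) D (false ∷ E) ≡ desSum (shuffles j k) D E
  desSum-startsWithFalse j k D E =
    sum-map-↭-map (weight D (false ∷ E)) (false ∷_) (filter-shuffles-↭ startsWithFalse? (false ∷_) {j} {k} ∷-injectiveʳ
                                 (λ _ → refl) (λ _ → refl) (λ _ → refl) starts)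
    where
    starts : ∀ {w} → head w ≡ just false → ∃[ u ] w ≡ false ∷ u
    starts {false ∷ u} refl = u , refl

  desSum-endsWithFalse : ∀ j k D E → length E ≡ k →
    desSum (filter endsWithFalse? (shuffles j (suc k))) D (E ∷ʳ false) ≡ desSum (shuffles j k) D E
  desSum-endsWithFalse j k D E ℓ =
    trans (sum-map-↭-map (weight D (E ∷ʳ false)) (_∷ʳ false)
            (filter-shuffles-↭ endsWithFalse? (_∷ʳ false) {j} {k} (∷ʳ-injectiveˡ _ _)
                               #true-∷ʳ-false #false-∷ʳ-false (λ u → lastOr-∷ʳ true u false) ends))
          (sum-map-cong-∈ (shuffles j k) λ {u} u∈ →
            cong (t ^_) (shuffleDes-∷ʳ-false 1 false u D E (trans ℓ (sym (proj₂ (∈-shuffles⁻ u∈))))))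
    where
    ends : ∀ {w} → lastOr true w ≡ false → ∃[ u ] w ≡ u ∷ʳ false
    ends {x ∷ w} = lastOr≡false⇒∷ʳ x w

  shuffles-swapLower : ∀ j k E → SwapInvariant (j ∸ 1) (λ D → desSum (shuffles j k) (false ∷ D) E)
  shuffles-swapLower j k E =
    desSum-swapLower E (shuffles-unique j k)
      (λ i → shuffles-closed (swapGapsAfter i) (swapGapsAfter-#true i) (swapGapsAfter-#false i)) (proj₁ ∘ ∈-shuffles⁻)

  shuffles-swapUpper : ∀ j k D → SwapInvariant k (desSum (shuffles j k) D)
  shuffles-swapUpper j k D =
    desSum-swapUpper D (shuffles-unique j k)
      (λ i → shuffles-closed (swapGapsAfterᶠ i) (swapGapsAfterᶠ-#true i) (swapGapsAfterᶠ-#false i)) (proj₂ ∘ ∈-shuffles⁻)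

  endsWithFalse-swapUpper : ∀ j k D → SwapInvariant (suc k) (desSum (filter endsWithFalse? (shuffles j (suc k))) D)
  endsWithFalse-swapUpper j k D =
    desSum-swapUpper D (Unique.filter⁺ endsWithFalse? (shuffles-unique j (suc k))) closed
      (proj₂ ∘ ∈-shuffles⁻ ∘ proj₁ ∘ ∈-filter⁻ endsWithFalse?)
    where
    closed : ∀ i {w} → w ∈ filter endsWithFalse? (shuffles j (suc k)) →
             swapGapsAfterᶠ i w ∈ filter endsWithFalse? (shuffles j (suc k))
    closed i w∈ with ∈-filter⁻ endsWithFalse? w∈
    ... | w∈shuffles , ends =
      ∈-filter⁺ endsWithFalse?
        (shuffles-closed (swapGapsAfterᶠ i) (swapGapsAfterᶠ-#true i) (swapGapsAfterᶠ-#false i) w∈shuffles)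
        (trans (swapGapsAfterᶠ-lastOr i true _) ends)

  desSum-endsWithFalse≡startsWithFalse : ∀ j k D₁ D₂ E₁ E₂ →
    length D₁ ≡ j ∸ 1 → length D₂ ≡ j ∸ 1 → #true D₁ ≡ #true D₂ →
    length E₁ ≡ k → length E₂ ≡ k → #true E₁ ≡ #true E₂ →
    desSum (filter endsWithFalse? (shuffles j (suc k))) (false ∷ D₁) (false ∷ E₁) ≡
    desSum (filter startsWithFalse? (shuffles j (suc k))) (false ∷ D₂) (false ∷ E₂)
  desSum-endsWithFalse≡startsWithFalse j k D₁ D₂ E₁ E₂ ℓD₁ ℓD₂ #D ℓE₁ ℓE₂ #E = begin
    desSum ends (false ∷ D₁) (false ∷ E₁)
      ≡⟨ swapInvariant-#true (desSum ends (false ∷ D₁)) (endsWithFalse-swapUpper j k (false ∷ D₁))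
                             (false ∷ E₁) (E₁ ∷ʳ false) (cong suc ℓE₁) ℓ∷ʳ (sym (#true-∷ʳ-false E₁)) ⟩
    desSum ends (false ∷ D₁) (E₁ ∷ʳ false)
      ≡⟨ desSum-endsWithFalse j k (false ∷ D₁) E₁ ℓE₁ ⟩
    desSum (shuffles j k) (false ∷ D₁) E₁
      ≡⟨ swapInvariant-#true (λ D → desSum (shuffles j k) (false ∷ D) E₁) (shuffles-swapLower j k E₁) D₁ D₂ ℓD₁ ℓD₂ #D ⟩
    desSum (shuffles j k) (false ∷ D₂) E₁
      ≡⟨ swapInvariant-#true (desSum (shuffles j k) (false ∷ D₂)) (shuffles-swapUpper j k (false ∷ D₂)) E₁ E₂ ℓE₁ ℓE₂ #E ⟩
    desSum (shuffles j k) (false ∷ D₂) E₂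
      ≡⟨ desSum-startsWithFalse j k (false ∷ D₂) E₂ ⟨
    desSum (filter startsWithFalse? (shuffles j (suc k))) (false ∷ D₂) (false ∷ E₂)
      ∎
    where
    open ≡-Reasoning
    ends = filter endsWithFalse? (shuffles j (suc k))
    ℓ∷ʳ : length (E₁ ∷ʳ false) ≡ suc k
    ℓ∷ʳ = trans (length-++ E₁) (trans (+-comm (length E₁) 1) (cong suc ℓE₁))

-- Permutations, positions and ranks

interval : ℕ → ℕ → List ℕ
interval a zero = []
interval a (suc m) = a ∷ interval (suc a) m

map-suc-applyUpTo : ∀ (f : ℕ → ℕ) a n → (∀ i → suc (f i) ≡ a + i) → map suc (applyUpTo f n) ≡ interval a n
map-suc-applyUpTo f a zero _ = refl
map-suc-applyUpTo f a (suc n) f≗ =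
  cong₂ _∷_ (trans (f≗ 0) (+-identityʳ a)) (map-suc-applyUpTo (f ∘ suc) (suc a) n (λ i → trans (f≗ (suc i)) (+-suc a i)))

range1≡interval : ∀ n → range1 n ≡ interval 1 n
range1≡interval n = map-suc-applyUpTo (λ i → i) 1 n (λ _ → refl)

∈-interval⁻ : ∀ {a m z} → z ∈ interval a m → a ≤ z × z < a + m
∈-interval⁻ {a} {suc m} (here refl) = ≤-refl , subst (a <_) (sym (+-suc a m)) (s≤s (m≤m+n a m))
∈-interval⁻ {a} {suc m} {z} (there z∈) with ∈-interval⁻ {suc a} {m} z∈
... | a<z , z< = <⇒≤ a<z , subst (z <_) (sym (+-suc a m)) z<

∈-interval⁺ : ∀ {a m z} → a ≤ z → z < a + m → z ∈ interval a m
∈-interval⁺ {a} {zero} {z} a≤z z< = ⊥-elim (<-irrefl refl (≤-trans z< (subst (_≤ z) (sym (+-identityʳ a)) a≤z)))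
∈-interval⁺ {a} {suc m} {z} a≤z z< with m≤n⇒m<n∨m≡n a≤z
... | inj₂ refl = here refl
... | inj₁ a<z = there (∈-interval⁺ {suc a} {m} a<z (subst (z <_) (+-suc a m) z<))

length-interval : ∀ a m → length (interval a m) ≡ m
length-interval a zero = refl
length-interval a (suc m) = cong suc (length-interval (suc a) m)

interval-unique : ∀ a m → Unique (interval a m)
interval-unique a zero = []
interval-unique a (suc m) =
  All.tabulate (λ z∈ a≡z → <-irrefl a≡z (proj₁ (∈-interval⁻ z∈))) ∷ interval-unique (suc a) m

map-interval-suc : {A : Set} (f : ℕ → A) (a m : ℕ) → map f (interval (suc a) m) ≡ map (f ∘ suc) (interval a m)
map-interval-suc f a zero = refl
map-interval-suc f a (suc m) = cong (f (suc a) ∷_) (map-interval-suc f (suc a) m)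

IsPerm-∈⁻ : ∀ {m x z} → IsPerm m x → z ∈ x → 1 ≤ z × z ≤ m
IsPerm-∈⁻ {m} {x} {z} x↭ z∈ with ∈-interval⁻ {1} {m} (subst (z ∈_) (range1≡interval m) (↭.∈-resp-↭ x↭ z∈))
... | 1≤z , z<1+m = 1≤z , ≤-pred z<1+m

IsPerm-∈⁺ : ∀ {m x z} → IsPerm m x → 1 ≤ z → z ≤ m → z ∈ x
IsPerm-∈⁺ {m} {x} {z} x↭ 1≤z z≤m =
  ↭.∈-resp-↭ (↭-sym x↭) (subst (z ∈_) (sym (range1≡interval m)) (∈-interval⁺ 1≤z (s≤s z≤m)))

IsPerm-unique : ∀ {m x} → IsPerm m x → Unique x
IsPerm-unique {m} x↭ =
  ↭ₛ.Unique-resp-↭ (setoid ℕ) (↭⇒↭ₛ (↭-sym x↭)) (subst Unique (sym (range1≡interval m)) (interval-unique 1 m))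

IsPerm-length : ∀ {m x} → IsPerm m x → length x ≡ m
IsPerm-length {m} x↭ = trans (↭.↭-length x↭) (trans (cong length (range1≡interval m)) (length-interval 1 m))

IsPerm-intro : ∀ {m x} → Unique x → (∀ z → z ∈ x ⇔ (1 ≤ z × z ≤ m)) → IsPerm m x
IsPerm-intro {m} ux ∈x⇔ = unique∧set⇒↭ ux (subst Unique (sym (range1≡interval m)) (interval-unique 1 m)) λ z →
  mk⇔ (λ z∈ → let (1≤z , z≤m) = Equivalence.to (∈x⇔ z) z∈ in
                subst (z ∈_) (sym (range1≡interval m)) (∈-interval⁺ 1≤z (s≤s z≤m)))
      (λ z∈ → let (1≤z , z<) = ∈-interval⁻ {1} {m} (subst (z ∈_) (range1≡interval m) z∈) in
                Equivalence.from (∈x⇔ z) (1≤z , ≤-pred z<))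

≡ᵇ-refl : ∀ v → (v ≡ᵇ v) ≡ true
≡ᵇ-refl zero = refl
≡ᵇ-refl (suc v) = ≡ᵇ-refl v

≡ᵇ-false : ∀ {v x} → v ≢ x → (v ≡ᵇ x) ≡ false
≡ᵇ-false {v} {x} v≢x with v ≡ᵇ x in eq
... | false = refl
... | true = ⊥-elim (v≢x (≡ᵇ⇒≡ v x (Equivalence.from T-≡ eq)))

<ᵇ-true : ∀ {m n} → m < n → (m <ᵇ n) ≡ true
<ᵇ-true m<n = Equivalence.to T-≡ (<⇒<ᵇ m<n)

<ᵇ-true⁻ : ∀ {m n} → (m <ᵇ n) ≡ true → m < n
<ᵇ-true⁻ {m} {n} eq = <ᵇ⇒< m n (Equivalence.from T-≡ eq)

<ᵇ-false : ∀ {m n} → ¬ m < n → (m <ᵇ n) ≡ false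
<ᵇ-false {m} {n} m≮n with m <ᵇ n in eq
... | false = refl
... | true = ⊥-elim (m≮n (<ᵇ-true⁻ eq))

<ᵇ-cong-⇔ : ∀ {a b c d} → (a < b ⇔ c < d) → (a <ᵇ b) ≡ (c <ᵇ d)
<ᵇ-cong-⇔ {a} {b} a<b⇔c<d with a <ᵇ b in eq
... | true = sym (<ᵇ-true (Equivalence.to a<b⇔c<d (<ᵇ-true⁻ eq)))
... | false = sym (<ᵇ-false (λ c<d → subst T eq (<⇒<ᵇ (Equivalence.from a<b⇔c<d c<d))))

indexOf-here : ∀ v xs → indexOf v (v ∷ xs) ≡ 0
indexOf-here v xs rewrite ≡ᵇ-refl v = refl

indexOf-there : ∀ {v x} xs → v ≢ x → indexOf v (x ∷ xs) ≡ suc (indexOf v xs)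
indexOf-there xs v≢x rewrite ≡ᵇ-false v≢x = refl

at-∈ : ∀ xs {p} → p < length xs → at xs p ∈ xs
at-∈ (x ∷ xs) {zero} _ = here refl
at-∈ (x ∷ xs) {suc p} (s≤s p<) = there (at-∈ xs p<)

at-map : ∀ (f : ℕ → ℕ) xs {p} → p < length xs → at (map f xs) p ≡ f (at xs p)
at-map f (x ∷ xs) {zero} _ = refl
at-map f (x ∷ xs) {suc p} (s≤s p<) = at-map f xs p<

at-indexOf : ∀ {v} xs → v ∈ xs → at xs (indexOf v xs) ≡ v
at-indexOf {v} (x ∷ xs) v∈ with v ≟ℕ x
... | yes refl rewrite indexOf-here v xs = refl
... | no v≢x rewrite indexOf-there xs v≢x = at-indexOf xs (Any.tail v≢x v∈)

indexOf-< : ∀ {v} xs → v ∈ xs → indexOf v xs < length xs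
indexOf-< {v} (x ∷ xs) v∈ with v ≟ℕ x
... | yes refl rewrite indexOf-here v xs = s≤s z≤n
... | no v≢x rewrite indexOf-there xs v≢x = s≤s (indexOf-< xs (Any.tail v≢x v∈))

indexOf-at : ∀ xs {p} → Unique xs → p < length xs → indexOf (at xs p) xs ≡ p
indexOf-at (x ∷ xs) {zero} _ _ = indexOf-here x xs
indexOf-at (x ∷ xs) {suc p} (x∉ ∷ uxs) (s≤s p<) =
  trans (indexOf-there xs (λ e → All.lookup x∉ (at-∈ xs p<) (sym e))) (cong suc (indexOf-at xs uxs p<))

indexOf-++ˡ : ∀ {v} xs ys → v ∈ xs → indexOf v (xs ++ ys) ≡ indexOf v xs
indexOf-++ˡ {v} (x ∷ xs) ys v∈ with v ≟ℕ x
... | yes refl = trans (indexOf-here v (xs ++ ys)) (sym (indexOf-here v xs))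
... | no v≢x = trans (indexOf-there (xs ++ ys) v≢x)
                     (trans (cong suc (indexOf-++ˡ xs ys (Any.tail v≢x v∈))) (sym (indexOf-there xs v≢x)))

indexOf-++ʳ : ∀ {v} xs ys → v ∉ xs → indexOf v (xs ++ ys) ≡ length xs + indexOf v ys
indexOf-++ʳ [] ys _ = refl
indexOf-++ʳ (x ∷ xs) ys v∉ = trans (indexOf-there (xs ++ ys) (v∉ ∘ here)) (cong suc (indexOf-++ʳ xs ys (v∉ ∘ there)))

at-ext : ∀ xs ys → length xs ≡ length ys → (∀ p → p < length xs → at xs p ≡ at ys p) → xs ≡ ys
at-ext [] [] _ _ = refl
at-ext (x ∷ xs) (y ∷ ys) ℓ at≡ =
  cong₂ _∷_ (at≡ 0 (s≤s z≤n)) (at-ext xs ys (suc-injective ℓ) (λ p p< → at≡ (suc p) (s≤s p<)))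

length-filterᵇ : {A : Set} (f : A → Bool) (xs : List A) → length (filterᵇ f xs) ≡ #true (map f xs)
length-filterᵇ f [] = refl
length-filterᵇ f (x ∷ xs) with f x
... | true = cong suc (length-filterᵇ f xs)
... | false = length-filterᵇ f xs

#true-map-cong-∈ : {A : Set} (xs : List A) {f g : A → Bool} → (∀ {x} → x ∈ xs → f x ≡ g x) →
                   #true (map f xs) ≡ #true (map g xs)
#true-map-cong-∈ xs f≗g = cong #true (map-cong-local (All.tabulate f≗g))

map-at-interval : ∀ xs → map (at xs) (interval 0 (length xs)) ≡ xs
map-at-interval [] = refl
map-at-interval (x ∷ xs) = cong (x ∷_) (trans (map-interval-suc (at (x ∷ xs)) 0 (length xs)) (map-at-interval xs))

#below : ℕ → List ℕ → ℕ
#below v xs = #true (map (_<ᵇ v) xs)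

#below-positions : ∀ v xs → #below v xs ≡ #true (map (λ p → at xs p <ᵇ v) (interval 0 (length xs)))
#below-positions v xs =
  trans (cong (#true ∘ map (_<ᵇ v)) (sym (map-at-interval xs))) (cong #true (sym (map-∘ (interval 0 (length xs)))))

∼-#below : ∀ {x′ x} → x′ ∼ x → ∀ {q} → q < length x′ → #below (at x′ q) x′ ≡ #below (at x q) x
∼-#below {x′} {x} (ℓ , ord) {q} q< = begin
  #below (at x′ q) x′                                             ≡⟨ #below-positions (at x′ q) x′ ⟩
  #true (map (λ p → at x′ p <ᵇ at x′ q) (interval 0 (length x′))) ≡⟨ #true-map-cong-∈ (interval 0 (length x′)) (λ p∈ →
                                                                       <ᵇ-cong-⇔ (ord _ q (proj₂ (∈-interval⁻ {0} p∈)) q<)) ⟩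
  #true (map (λ p → at x p <ᵇ at x q) (interval 0 (length x′)))   ≡⟨ cong (λ n → #true (map (λ p → at x p <ᵇ at x q) (interval 0 n))) ℓ ⟩
  #true (map (λ p → at x p <ᵇ at x q) (interval 0 (length x)))    ≡⟨ #below-positions (at x q) x ⟨
  #below (at x q) x                                               ∎
  where open ≡-Reasoning

IsPerm-#below : ∀ {m x a} → IsPerm m x → a ∈ x → #below a x ≡ a ∸ 1
IsPerm-#below {m} {x} {a} x↭ a∈ = begin
  #below a x                       ≡⟨ length-filterᵇ (_<ᵇ a) x ⟨
  length (filterᵇ (_<ᵇ a) x)       ≡⟨ ↭.↭-length (unique∧set⇒↭ (Unique.filter⁺ (T? ∘ (_<ᵇ a)) (IsPerm-unique x↭))
                                                               (interval-unique 1 (a ∸ 1)) same-members) ⟩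
  length (interval 1 (a ∸ 1))      ≡⟨ length-interval 1 (a ∸ 1) ⟩
  a ∸ 1                            ∎
  where
  open ≡-Reasoning
  1≤a = proj₁ (IsPerm-∈⁻ x↭ a∈)
  a≡ : 1 + (a ∸ 1) ≡ a
  a≡ = m+[n∸m]≡n 1≤a
  same-members : ∀ z → z ∈ filterᵇ (_<ᵇ a) x ⇔ z ∈ interval 1 (a ∸ 1)
  same-members z = mk⇔
    (λ z∈ → let (z∈x , z<a) = ∈-filter⁻ (T? ∘ (_<ᵇ a)) {xs = x} z∈ in
            ∈-interval⁺ (proj₁ (IsPerm-∈⁻ x↭ z∈x)) (subst (z <_) (sym a≡) (<ᵇ⇒< z a z<a)))
    (λ z∈ → let (1≤z , z<) = ∈-interval⁻ {1} {a ∸ 1} z∈ ; z<a = subst (z <_) a≡ z< in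
            ∈-filter⁺ (T? ∘ (_<ᵇ a)) (IsPerm-∈⁺ x↭ 1≤z (≤-trans (<⇒≤ z<a) (proj₂ (IsPerm-∈⁻ x↭ a∈)))) (<⇒<ᵇ z<a))

∼-at-indexOf : ∀ {m x′ x v} → x′ ∼ x → IsPerm m x → v ∈ x′ → at x (indexOf v x′) ≡ suc (#below v x′)
∼-at-indexOf {m} {x′} {x} {v} x′∼x x↭ v∈ = sym (begin
  suc (#below v x′)             ≡⟨ cong (λ u → suc (#below u x′)) (at-indexOf x′ v∈) ⟨
  suc (#below (at x′ q) x′)     ≡⟨ cong suc (∼-#below {x′} {x} x′∼x q<) ⟩
  suc (#below (at x q) x)       ≡⟨ cong suc (IsPerm-#below x↭ a∈) ⟩
  suc (at x q ∸ 1)              ≡⟨ m+[n∸m]≡n (proj₁ (IsPerm-∈⁻ x↭ a∈)) ⟩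
  at x q                        ∎)
  where
  open ≡-Reasoning
  q = indexOf v x′
  q< = indexOf-< x′ v∈
  a∈ = at-∈ x (subst (q <_) (proj₁ x′∼x) q<)

#below-colouring : ∀ {x′} (P : ℕ → Bool) v → Unique x′ → (∀ {u} → u ∈ x′ → 2 ≤ u) → 2 ≤ v →
  (∀ {u} → 2 ≤ u → u < v → (T (P u) ⇔ u ∈ x′)) → #true (map P (interval 2 (v ∸ 2))) ≡ #below v x′
#below-colouring {x′} P v ux′ ≥2 2≤v P⇔ = begin
  #true (map P (interval 2 (v ∸ 2)))        ≡⟨ length-filterᵇ P (interval 2 (v ∸ 2)) ⟨
  length (filterᵇ P (interval 2 (v ∸ 2)))   ≡⟨ ↭.↭-length (unique∧set⇒↭ (Unique.filter⁺ (T? ∘ P) (interval-unique 2 (v ∸ 2)))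
                                                                      (Unique.filter⁺ (T? ∘ (_<ᵇ v)) ux′) same-members) ⟩
  length (filterᵇ (_<ᵇ v) x′)               ≡⟨ length-filterᵇ (_<ᵇ v) x′ ⟩
  #below v x′                                ∎
  where
  open ≡-Reasoning
  v≡ : 2 + (v ∸ 2) ≡ v
  v≡ = m+[n∸m]≡n 2≤v
  same-members : ∀ z → z ∈ filterᵇ P (interval 2 (v ∸ 2)) ⇔ z ∈ filterᵇ (_<ᵇ v) x′
  same-members z = mk⇔
    (λ z∈ → let (z∈I , Pz) = ∈-filter⁻ (T? ∘ P) {xs = interval 2 (v ∸ 2)} z∈
                (2≤z , z<) = ∈-interval⁻ {2} {v ∸ 2} z∈I
                z<v = subst (z <_) v≡ z< in
            ∈-filter⁺ (T? ∘ (_<ᵇ v)) (Equivalence.to (P⇔ 2≤z z<v) Pz) (<⇒<ᵇ z<v))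
    (λ z∈ → let (z∈x′ , z<v) = ∈-filter⁻ (T? ∘ (_<ᵇ v)) {xs = x′} z∈
                z<v = <ᵇ⇒< z v z<v in
            ∈-filter⁺ (T? ∘ P) (∈-interval⁺ (≥2 z∈x′) (subst (z <_) (sym v≡) z<v))
                      (Equivalence.from (P⇔ (≥2 z∈x′) z<v) z∈x′))

indexOf-rank : ∀ {m x′ x v} → x′ ∼ x → IsPerm m x → v ∈ x′ → indexOf (suc (#below v x′)) x ≡ indexOf v x′
indexOf-rank {m} {x′} {x} {v} x′∼x x↭ v∈ =
  trans (cong (λ u → indexOf u x) (sym (∼-at-indexOf x′∼x x↭ v∈)))
        (indexOf-at x (IsPerm-unique x↭) (subst (indexOf v x′ <_) (proj₁ x′∼x) (indexOf-< x′ v∈)))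

-- Inverses of the permutations σ′ 1 τ′

merge : List Bool → List ℕ → List ℕ → List ℕ
merge [] xs ys = []
merge (true ∷ w) [] ys = []
merge (true ∷ w) (x ∷ xs) ys = x ∷ merge w xs ys
merge (false ∷ w) xs [] = []
merge (false ∷ w) xs (y ∷ ys) = y ∷ merge w xs ys

ColourRanked : ℕ → ℕ → ℕ → ℕ → (ℕ → Bool) → (f g h : ℕ → ℕ) → Set
ColourRanked m s a b c f g h =
  ∀ i → i < m → f (s + i) ≡ (if c (s + i) then g (a + #true (map c (interval s i)))
                                           else h (b + #false (map c (interval s i))))

map-as-merge : ∀ m s a b (c : ℕ → Bool) (f g h : ℕ → ℕ) → ColourRanked m s a b c f g h →
  map f (interval s m) ≡
  merge (map c (interval s m)) (map g (interval a (#true (map c (interval s m)))))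
                               (map h (interval b (#false (map c (interval s m)))))
map-as-merge zero s a b c f g h ranked = refl
map-as-merge (suc m) s a b c f g h ranked with c s in cs
... | true = cong₂ _∷_ head≡ (map-as-merge m (suc s) (suc a) b c f g h ranked′)
  where
  head≡ : f s ≡ g a
  head≡ with ranked 0 (s≤s z≤n)
  ... | e rewrite +-identityʳ s | cs | +-identityʳ a = e
  ranked′ : ColourRanked m (suc s) (suc a) b c f g h
  ranked′ i i< with ranked (suc i) (s≤s i<)
  ... | e rewrite +-suc s i | cs | +-suc a (#true (map c (interval (suc s) i))) = e
... | false = cong₂ _∷_ head≡ (map-as-merge m (suc s) a (suc b) c f g h ranked′)
  where
  head≡ : f s ≡ h b
  head≡ with ranked 0 (s≤s z≤n)
  ... | e rewrite +-identityʳ s | cs | +-identityʳ b = e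
  ranked′ : ColourRanked m (suc s) a (suc b) c f g h
  ranked′ i i< with ranked (suc i) (s≤s i<)
  ... | e rewrite +-suc s i | cs | +-suc b (#false (map c (interval (suc s) i))) = e

descentsFrom : ℕ → List ℕ → List Bool
descentsFrom a [] = []
descentsFrom a (x ∷ xs) = (x <ᵇ a) ∷ descentsFrom x xs

descents : List ℕ → List Bool
descents [] = []
descents (x ∷ xs) = descentsFrom x xs

#true-descents : ∀ xs → #true (descents xs) ≡ des xs
#true-descents [] = refl
#true-descents (x ∷ []) = refl
#true-descents (x ∷ y ∷ xs) = cong (bit (y <ᵇ x) +_) (#true-descents (y ∷ xs))

length-descentsFrom : ∀ a xs → length (descentsFrom a xs) ≡ length xs
length-descentsFrom a [] = refl
length-descentsFrom a (x ∷ xs) = cong suc (length-descentsFrom x xs)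

length-descents : ∀ xs → length (descents xs) ≡ length xs ∸ 1
length-descents [] = refl
length-descents (x ∷ xs) = length-descentsFrom x xs

-- p says whether the entry before the merge is a (from the lower side) or b (from the upper side).
des-merge : ∀ w xs ys p a b M → #true w ≡ length xs → #false w ≡ length ys →
  a < M → All (_< M) xs → M ≤ b → All (M ≤_) ys →
  des ((if p then a else b) ∷ merge w xs ys) ≡ shuffleDes 1 0 p w (descentsFrom a xs) (descentsFrom b ys)
des-merge [] xs ys p a b M _ _ _ _ _ _ = refl
des-merge (true ∷ w) (x ∷ xs) ys true a b M ℓx ℓy a<M (x<M ∷ xs<M) M≤b M≤ys =
  cong (bit (x <ᵇ a) +_) (des-merge w xs ys true x b M (suc-injective ℓx) ℓy x<M xs<M M≤b M≤ys)
des-merge (true ∷ w) (x ∷ xs) ys false a b M ℓx ℓy a<M (x<M ∷ xs<M) M≤b M≤ys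
  rewrite <ᵇ-true (<-≤-trans x<M M≤b) =
  cong suc (des-merge w xs ys true x b M (suc-injective ℓx) ℓy x<M xs<M M≤b M≤ys)
des-merge (false ∷ w) xs (y ∷ ys) true a b M ℓx ℓy a<M xs<M M≤b (M≤y ∷ M≤ys)
  rewrite <ᵇ-false (<⇒≱ (<-≤-trans a<M M≤y) ∘ <⇒≤) =
  des-merge w xs ys false a y M ℓx (suc-injective ℓy) a<M xs<M M≤y M≤ys
des-merge (false ∷ w) xs (y ∷ ys) false a b M ℓx ℓy a<M xs<M M≤b (M≤y ∷ M≤ys) =
  cong (bit (y <ᵇ b) +_) (des-merge w xs ys false a y M ℓx (suc-injective ℓy) a<M xs<M M≤y M≤ys)

shuffleDes-[]ᴰ : ∀ a b p w E → shuffleDes a b p w [] E ≡ shuffleDes a b p w [ false ] E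
shuffleDes-[]ᴰ a b p [] E = refl
shuffleDes-[]ᴰ a b p (true ∷ w) E = refl
shuffleDes-[]ᴰ a b p (false ∷ w) E = cong ((if p then b else hd E) +_) (shuffleDes-[]ᴰ a b false w (tl E))

shuffleDes-[]ᴱ : ∀ a b p w D → shuffleDes a b p w D [] ≡ shuffleDes a b p w D [ false ]
shuffleDes-[]ᴱ a b p [] D = refl
shuffleDes-[]ᴱ a b p (true ∷ w) D = cong ((if p then hd D else a) +_) (shuffleDes-[]ᴱ a b true w (tl D))
shuffleDes-[]ᴱ a b p (false ∷ w) D = refl

shuffleDes-descentsFrom-0 : ∀ a b p w xs E →
  shuffleDes a b p w (descentsFrom 0 xs) E ≡ shuffleDes a b p w (false ∷ descents xs) E
shuffleDes-descentsFrom-0 a b p w [] E = shuffleDes-[]ᴰ a b p w E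
shuffleDes-descentsFrom-0 a b p w (x ∷ xs) E = refl

+-<ᵇ-+ : ∀ s y z → (s + y <ᵇ s + z) ≡ (y <ᵇ z)
+-<ᵇ-+ zero y z = refl
+-<ᵇ-+ (suc s) y z = +-<ᵇ-+ s y z

+-<ᵇ-self : ∀ s y → (s + y <ᵇ s) ≡ false
+-<ᵇ-self zero y = refl
+-<ᵇ-self (suc s) y = +-<ᵇ-self s y

descentsFrom-shift : ∀ s y ys → descentsFrom (s + y) (map (s +_) ys) ≡ descentsFrom y ys
descentsFrom-shift s y [] = refl
descentsFrom-shift s y (z ∷ ys) = cong₂ _∷_ (+-<ᵇ-+ s z y) (descentsFrom-shift s z ys)

shuffleDes-descentsFrom-shift : ∀ a b p w D s ys →
  shuffleDes a b p w D (descentsFrom s (map (s +_) ys)) ≡ shuffleDes a b p w D (false ∷ descents ys)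
shuffleDes-descentsFrom-shift a b p w D s [] = shuffleDes-[]ᴱ a b p w D
shuffleDes-descentsFrom-shift a b p w D s (y ∷ ys) rewrite +-<ᵇ-self s y | descentsFrom-shift s y ys = refl

Unique-++⁻ : {A : Set} (xs : List A) {ys : List A} → Unique (xs ++ ys) →
             Unique xs × Unique ys × (∀ {z} → z ∈ xs → z ∉ ys)
Unique-++⁻ [] uys = [] , uys , λ ()
Unique-++⁻ (x ∷ xs) (x∉ ∷ u) with Unique-++⁻ xs u
... | uxs , uys , disjoint =
  All.tabulate (λ z∈ → All.lookup x∉ (∈-++⁺ˡ z∈)) ∷ uxs , uys ,
  λ { (here refl) z∈ys → All.lookup x∉ (∈-++⁺ʳ xs z∈ys) refl ; (there z∈) → disjoint z∈ }

Unique-map⁺-on : {A B : Set} {xs : List A} (f : A → B) → Unique xs →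
                 (∀ {x y} → x ∈ xs → y ∈ xs → f x ≡ f y → x ≡ y) → Unique (map f xs)
Unique-map⁺-on {xs = []} f _ _ = []
Unique-map⁺-on {xs = x ∷ xs} f (x∉ ∷ uxs) injective =
  All.tabulate fx∉ ∷ Unique-map⁺-on f uxs (λ y∈ z∈ → injective (there y∈) (there z∈))
  where
  fx∉ : ∀ {z} → z ∈ map f xs → f x ≢ z
  fx∉ z∈ fx≡ with ∈-map⁻ f z∈
  ... | y , y∈ , refl = All.lookup x∉ y∈ (injective (here refl) (there y∈) fx≡)

length-inverse : ∀ x → length (inverse x) ≡ length x
length-inverse x = trans (length-map _ (range1 (length x)))
                         (trans (cong length (range1≡interval (length x))) (length-interval 1 (length x)))

inverse≡map-interval : ∀ {m x} → IsPerm m x → inverse x ≡ map (λ v → suc (indexOf v x)) (interval 1 m)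
inverse≡map-interval {m} {x} x↭ = cong (map (λ v → suc (indexOf v x))) (trans (cong range1 (IsPerm-length x↭)) (range1≡interval m))

All-inverse-≤ : ∀ {m x} → IsPerm m x → All (_≤ m) (inverse x)
All-inverse-≤ {m} {x} x↭ = subst (All (_≤ m)) (sym (inverse≡map-interval x↭)) (All.tabulate bounded)
  where
  bounded : ∀ {z} → z ∈ map (λ v → suc (indexOf v x)) (interval 1 m) → z ≤ m
  bounded z∈ with ∈-map⁻ _ z∈
  ... | v , v∈ , refl with ∈-interval⁻ {1} {m} v∈
  ...   | 1≤v , v< = subst (indexOf v x <_) (IsPerm-length x↭) (indexOf-< x (IsPerm-∈⁺ x↭ 1≤v (≤-pred v<)))

leftOfOne : List ℕ → ℕ → Bool
leftOfOne μ v = indexOf v μ <ᵇ indexOf 1 μ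

colours : ℕ → List ℕ → List Bool
colours m μ = map (leftOfOne μ) (interval 2 m)

module Split {j k : ℕ} {σ τ σ′ τ′ : List ℕ} (σ↭ : IsPerm j σ) (τ↭ : IsPerm k τ)
             (μ↭ : IsPerm (j + k + 1) (σ′ ++ 1 ∷ τ′)) (σ′∼σ : σ′ ∼ σ) (τ′∼τ : τ′ ∼ τ) where

  μ : List ℕ
  μ = σ′ ++ 1 ∷ τ′

  n≡ : j + k + 1 ≡ suc (j + k)
  n≡ = +-comm (j + k) 1

  σ′-unique : Unique σ′
  σ′-unique = proj₁ (Unique-++⁻ σ′ (IsPerm-unique μ↭))

  1∉σ′ : 1 ∉ σ′
  1∉σ′ 1∈ = proj₂ (proj₂ (Unique-++⁻ σ′ (IsPerm-unique μ↭))) 1∈ (here refl)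

  σ′∩τ′ : ∀ {v} → v ∈ σ′ → v ∉ τ′
  σ′∩τ′ v∈ = proj₂ (proj₂ (Unique-++⁻ σ′ (IsPerm-unique μ↭))) v∈ ∘ there

  τ′-unique : Unique τ′
  τ′-unique with proj₁ (proj₂ (Unique-++⁻ σ′ (IsPerm-unique μ↭)))
  ... | _ ∷ u = u

  1∉τ′ : 1 ∉ τ′
  1∉τ′ 1∈ with proj₁ (proj₂ (Unique-++⁻ σ′ (IsPerm-unique μ↭)))
  ... | 1∉ ∷ _ = All.lookup 1∉ 1∈ refl

  length-σ′ : length σ′ ≡ j
  length-σ′ = trans (proj₁ σ′∼σ) (IsPerm-length σ↭)

  ≥2 : ∀ {v} → v ∈ μ → v ≢ 1 → 2 ≤ v
  ≥2 v∈ v≢1 with IsPerm-∈⁻ μ↭ v∈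
  ... | s≤s z≤n , _ = ≤∧≢⇒< (s≤s z≤n) (v≢1 ∘ sym)

  ≤n : ∀ {v} → v ∈ μ → v ≤ suc (j + k)
  ≤n {v} v∈ = subst (v ≤_) n≡ (proj₂ (IsPerm-∈⁻ μ↭ v∈))

  ≥2-σ′ : ∀ {v} → v ∈ σ′ → 2 ≤ v
  ≥2-σ′ v∈ = ≥2 (∈-++⁺ˡ v∈) (λ { refl → 1∉σ′ v∈ })

  ≥2-τ′ : ∀ {v} → v ∈ τ′ → 2 ≤ v
  ≥2-τ′ v∈ = ≥2 (∈-++⁺ʳ σ′ (there v∈)) (λ { refl → 1∉τ′ v∈ })

  indexOf-1 : indexOf 1 μ ≡ j
  indexOf-1 = trans (indexOf-++ʳ σ′ (1 ∷ τ′) 1∉σ′)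
                    (trans (cong (length σ′ +_) (indexOf-here 1 τ′)) (trans (+-identityʳ _) length-σ′))

  indexOf-σ′ : ∀ {v} → v ∈ σ′ → indexOf v μ ≡ indexOf v σ′
  indexOf-σ′ = indexOf-++ˡ σ′ (1 ∷ τ′)

  indexOf-τ′ : ∀ {v} → v ∈ τ′ → indexOf v μ ≡ j + suc (indexOf v τ′)
  indexOf-τ′ {v} v∈ = trans (indexOf-++ʳ σ′ (1 ∷ τ′) (λ v∈σ′ → σ′∩τ′ v∈σ′ v∈))
    (cong₂ _+_ length-σ′ (indexOf-there τ′ (λ { refl → 1∉τ′ v∈ })))

  c : ℕ → Bool
  c = leftOfOne μ

  c-σ′ : ∀ {v} → v ∈ σ′ → c v ≡ true
  c-σ′ {v} v∈ rewrite indexOf-1 | indexOf-σ′ v∈ = <ᵇ-true (subst (indexOf v σ′ <_) length-σ′ (indexOf-< σ′ v∈))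

  c-τ′ : ∀ {v} → v ∈ τ′ → c v ≡ false
  c-τ′ {v} v∈ rewrite indexOf-1 | indexOf-τ′ v∈ = <ᵇ-false (λ lt → <⇒≱ lt (m≤m+n j _))

  σ′⊎τ′ : ∀ {v} → 2 ≤ v → v ≤ suc (j + k) → v ∈ σ′ ⊎ v ∈ τ′
  σ′⊎τ′ {v} 2≤v v≤ with ∈-++⁻ σ′ (IsPerm-∈⁺ μ↭ (<⇒≤ 2≤v) (subst (v ≤_) (sym n≡) v≤))
  ... | inj₁ v∈ = inj₁ v∈
  ... | inj₂ (here refl) with s≤s () ← 2≤v
  ... | inj₂ (there v∈) = inj₂ v∈

  T-c⇔σ′ : ∀ {v} → 2 ≤ v → v ≤ suc (j + k) → (T (c v) ⇔ v ∈ σ′)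
  T-c⇔σ′ {v} 2≤v v≤ = mk⇔ to (λ v∈ → Equivalence.from T-≡ (c-σ′ v∈))
    where
    to : T (c v) → v ∈ σ′
    to Tc with σ′⊎τ′ 2≤v v≤
    ... | inj₁ v∈ = v∈
    ... | inj₂ v∈ with () ← subst T (c-τ′ v∈) Tc

  T-not-c⇔τ′ : ∀ {v} → 2 ≤ v → v ≤ suc (j + k) → (T (not (c v)) ⇔ v ∈ τ′)
  T-not-c⇔τ′ {v} 2≤v v≤ = mk⇔ to (λ v∈ → Equivalence.from T-not-≡ (c-τ′ v∈))
    where
    to : T (not (c v)) → v ∈ τ′
    to Tc with σ′⊎τ′ 2≤v v≤
    ... | inj₂ v∈ = v∈
    ... | inj₁ v∈ with () ← subst (T ∘ not) (c-σ′ v∈) Tc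

  #true-colours : #true (colours (j + k) μ) ≡ j
  #true-colours = begin
    #true (map c (interval 2 (j + k)))       ≡⟨ length-filterᵇ c (interval 2 (j + k)) ⟨
    length (filterᵇ c (interval 2 (j + k)))  ≡⟨ ↭.↭-length (unique∧set⇒↭ (Unique.filter⁺ (T? ∘ c) (interval-unique 2 (j + k)))
                                                                         σ′-unique same-members) ⟩
    length σ′                                ≡⟨ length-σ′ ⟩
    j                                        ∎
    where
    open ≡-Reasoning
    same-members : ∀ v → v ∈ filterᵇ c (interval 2 (j + k)) ⇔ v ∈ σ′
    same-members v = mk⇔
      (λ v∈ → let (v∈I , Tc) = ∈-filter⁻ (T? ∘ c) {xs = interval 2 (j + k)} v∈
                  (2≤v , v<) = ∈-interval⁻ {2} {j + k} v∈I in
              Equivalence.to (T-c⇔σ′ 2≤v (≤-pred v<)) Tc)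
      (λ v∈ → ∈-filter⁺ (T? ∘ c) (∈-interval⁺ (≥2-σ′ v∈) (s≤s (≤n (∈-++⁺ˡ v∈))))
                                 (Equivalence.from T-≡ (c-σ′ v∈)))

  #false-colours : #false (colours (j + k) μ) ≡ k
  #false-colours = +-cancelˡ-≡ j _ k (begin
    j + #false (colours (j + k) μ)                          ≡⟨ cong (_+ #false (colours (j + k) μ)) #true-colours ⟨
    #true (colours (j + k) μ) + #false (colours (j + k) μ)  ≡⟨ #true+#false≡length (colours (j + k) μ) ⟩
    length (colours (j + k) μ)                              ≡⟨ length-map c (interval 2 (j + k)) ⟩
    length (interval 2 (j + k))                             ≡⟨ length-interval 2 (j + k) ⟩
    j + k                                                   ∎)
    where open ≡-Reasoning

  #colour-below : ∀ {v} → v ∈ μ → v ≢ 1 → (P : ℕ → Bool) (x′ : List ℕ) → Unique x′ → (∀ {u} → u ∈ x′ → 2 ≤ u) →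
    (∀ {u} → 2 ≤ u → u ≤ suc (j + k) → (T (P u) ⇔ u ∈ x′)) → #true (map P (interval 2 (v ∸ 2))) ≡ #below v x′
  #colour-below v∈ v≢1 P x′ ux′ ≥2x′ P⇔ =
    #below-colouring P _ ux′ ≥2x′ (≥2 v∈ v≢1) (λ 2≤u u<v → P⇔ 2≤u (≤-trans (<⇒≤ u<v) (≤n v∈)))

  colours-ranked : ColourRanked (j + k) 2 1 1 c (λ v → suc (indexOf v μ))
                                 (λ m → suc (indexOf m σ)) (λ m → suc j + suc (indexOf m τ))
  colours-ranked i i< with σ′⊎τ′ {2 + i} (s≤s (s≤s z≤n)) (s≤s i<)
  ... | inj₁ v∈ rewrite c-σ′ v∈ = cong suc (begin
    indexOf (2 + i) μ                                       ≡⟨ indexOf-σ′ v∈ ⟩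
    indexOf (2 + i) σ′                                      ≡⟨ indexOf-rank σ′∼σ σ↭ v∈ ⟨
    indexOf (suc (#below (2 + i) σ′)) σ                      ≡⟨ cong (λ r → indexOf (suc r) σ)
                                                                  (#colour-below (∈-++⁺ˡ v∈) (λ ()) c σ′ σ′-unique ≥2-σ′ T-c⇔σ′) ⟨
    indexOf (suc (#true (map c (interval 2 i)))) σ           ∎)
    where open ≡-Reasoning
  ... | inj₂ v∈ rewrite c-τ′ v∈ = cong suc (begin
    indexOf (2 + i) μ                                       ≡⟨ indexOf-τ′ v∈ ⟩
    j + suc (indexOf (2 + i) τ′)                            ≡⟨ cong (λ r → j + suc r) (indexOf-rank τ′∼τ τ↭ v∈) ⟨
    j + suc (indexOf (suc (#below (2 + i) τ′)) τ)            ≡⟨ cong (λ r → j + suc (indexOf (suc r) τ)) #false≡ ⟨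
    j + suc (indexOf (suc (#false (map c (interval 2 i)))) τ) ∎)
    where
    open ≡-Reasoning
    #false≡ : #false (map c (interval 2 i)) ≡ #below (2 + i) τ′
    #false≡ = trans (sym (#true-map-not (map c (interval 2 i))))
                    (trans (cong #true (sym (map-∘ (interval 2 i))))
                           (#colour-below (∈-++⁺ʳ σ′ (there v∈)) (λ ()) (not ∘ c) τ′ τ′-unique ≥2-τ′ T-not-c⇔τ′))

  inverse-μ : inverse μ ≡ suc j ∷ merge (colours (j + k) μ) (inverse σ) (map (suc j +_) (inverse τ))
  inverse-μ = begin
    inverse μ
      ≡⟨ trans (inverse≡map-interval μ↭) (cong (map (λ v → suc (indexOf v μ)) ∘ interval 1) n≡) ⟩
    suc (indexOf 1 μ) ∷ map (λ v → suc (indexOf v μ)) (interval 2 (j + k))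
      ≡⟨ cong₂ _∷_ (cong suc indexOf-1) (map-as-merge (j + k) 2 1 1 c _ _ _ colours-ranked) ⟩
    suc j ∷ merge (colours (j + k) μ) (map (λ m → suc (indexOf m σ)) (interval 1 (#true (colours (j + k) μ))))
                                      (map (λ m → suc j + suc (indexOf m τ)) (interval 1 (#false (colours (j + k) μ))))
      ≡⟨ cong₂ (λ a b → suc j ∷ merge (colours (j + k) μ) (map (λ m → suc (indexOf m σ)) (interval 1 a))
                                                           (map (λ m → suc j + suc (indexOf m τ)) (interval 1 b)))
               #true-colours #false-colours ⟩
    suc j ∷ merge (colours (j + k) μ) (map (λ m → suc (indexOf m σ)) (interval 1 j))
                                      (map (λ m → suc j + suc (indexOf m τ)) (interval 1 k))
      ≡⟨ cong₂ (λ xs ys → suc j ∷ merge (colours (j + k) μ) xs ys)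
               (sym (inverse≡map-interval σ↭)) (trans (map-∘ (interval 1 k)) (cong (map (suc j +_)) (sym (inverse≡map-interval τ↭)))) ⟩
    suc j ∷ merge (colours (j + k) μ) (inverse σ) (map (suc j +_) (inverse τ))
      ∎
    where open ≡-Reasoning

  -- The leading false of either descent word stands for the entry j + 1 of μ⁻¹.
  ides-μ : ides μ ≡ shuffleDes 1 0 false (colours (j + k) μ) (false ∷ descents (inverse σ)) (false ∷ descents (inverse τ))
  ides-μ = begin
    des (inverse μ)
      ≡⟨ cong des inverse-μ ⟩
    des (suc j ∷ merge w (inverse σ) (map (suc j +_) (inverse τ)))
      ≡⟨ des-merge w (inverse σ) (map (suc j +_) (inverse τ)) false 0 (suc j) (suc j)
                   (trans #true-colours (sym (trans (length-inverse σ) (IsPerm-length σ↭))))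
                   (trans #false-colours (sym (trans (length-map _ (inverse τ)) (trans (length-inverse τ) (IsPerm-length τ↭)))))
                   (s≤s z≤n) (All.map s≤s (All-inverse-≤ σ↭)) ≤-refl (AllP.map⁺ (All.universal (m≤m+n (suc j)) (inverse τ))) ⟩
    shuffleDes 1 0 false w (descentsFrom 0 (inverse σ)) (descentsFrom (suc j) (map (suc j +_) (inverse τ)))
      ≡⟨ shuffleDes-descentsFrom-0 1 0 false w (inverse σ) _ ⟩
    shuffleDes 1 0 false w (false ∷ descents (inverse σ)) (descentsFrom (suc j) (map (suc j +_) (inverse τ)))
      ≡⟨ shuffleDes-descentsFrom-shift 1 0 false w _ (suc j) (inverse τ) ⟩
    shuffleDes 1 0 false w (false ∷ descents (inverse σ)) (false ∷ descents (inverse τ))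
      ∎
    where
    open ≡-Reasoning
    w = colours (j + k) μ

-- Permutations σ′ 1 τ′ with a prescribed colour word

letter : List Bool → ℕ → Bool
letter [] p = false
letter (b ∷ w) zero = b
letter (b ∷ w) (suc p) = letter w p

letter-map-not : ∀ w {p} → p < length w → letter (map not w) p ≡ not (letter w p)
letter-map-not (b ∷ w) {zero} _ = refl
letter-map-not (b ∷ w) {suc p} (s≤s p<) = letter-map-not w p<

map-interval-letter : ∀ (f : ℕ → Bool) a w → (∀ p → p < length w → f (a + p) ≡ letter w p) →
                      map f (interval a (length w)) ≡ w
map-interval-letter f a [] _ = refl
map-interval-letter f a (b ∷ w) f≡ =
  cong₂ _∷_ (trans (cong f (sym (+-identityʳ a))) (f≡ 0 (s≤s z≤n)))
            (map-interval-letter f (suc a) w (λ p p< → trans (cong f (sym (+-suc a p))) (f≡ (suc p) (s≤s p<))))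

-- The position of the letter true number m of w, both counted from 0.
posTrue : List Bool → ℕ → ℕ
posTrue [] m = 0
posTrue (true ∷ w) zero = 0
posTrue (true ∷ w) (suc m) = suc (posTrue w m)
posTrue (false ∷ w) m = suc (posTrue w m)

posTrue-< : ∀ w {m} → m < #true w → posTrue w m < length w
posTrue-< (true ∷ w) {zero} _ = s≤s z≤n
posTrue-< (true ∷ w) {suc m} (s≤s m<) = s≤s (posTrue-< w m<)
posTrue-< (false ∷ w) m< = s≤s (posTrue-< w m<)

letter-posTrue : ∀ w {m} → m < #true w → letter w (posTrue w m) ≡ true
letter-posTrue (true ∷ w) {zero} _ = refl
letter-posTrue (true ∷ w) {suc m} (s≤s m<) = letter-posTrue w m<
letter-posTrue (false ∷ w) m< = letter-posTrue w m<

posTrue-mono : ∀ w {m m′} → m < m′ → m′ < #true w → posTrue w m < posTrue w m′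
posTrue-mono (true ∷ w) {zero} {suc m′} _ _ = s≤s z≤n
posTrue-mono (true ∷ w) {suc m} {suc m′} (s≤s m<m′) (s≤s m′<) = s≤s (posTrue-mono w m<m′ m′<)
posTrue-mono (false ∷ w) m<m′ m′< = s≤s (posTrue-mono w m<m′ m′<)

posTrue-<⇔ : ∀ w {m m′} → m < #true w → m′ < #true w → (posTrue w m < posTrue w m′ ⇔ m < m′)
posTrue-<⇔ w {m} {m′} m< m′< = mk⇔ reflects (λ m<m′ → posTrue-mono w m<m′ m′<)
  where
  reflects : posTrue w m < posTrue w m′ → m < m′
  reflects pos< with <-cmp m m′
  ... | tri< m<m′ _ _ = m<m′
  ... | tri≈ _ refl _ = ⊥-elim (<-irrefl refl pos<)
  ... | tri> _ _ m′<m = ⊥-elim (<-asym pos< (posTrue-mono w m′<m m<))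

posTrue-injective : ∀ w {m m′} → m < #true w → m′ < #true w → posTrue w m ≡ posTrue w m′ → m ≡ m′
posTrue-injective w {m} {m′} m< m′< pos≡ with <-cmp m m′
... | tri< m<m′ _ _ = ⊥-elim (<-irrefl pos≡ (posTrue-mono w m<m′ m′<))
... | tri≈ _ m≡m′ _ = m≡m′
... | tri> _ _ m′<m = ⊥-elim (<-irrefl (sym pos≡) (posTrue-mono w m′<m m<))

posTrue-#true-take : ∀ w {p} → p < length w → letter w p ≡ true →
                     #true (take p w) < #true w × posTrue w (#true (take p w)) ≡ p
posTrue-#true-take (true ∷ w) {zero} _ _ = s≤s z≤n , refl
posTrue-#true-take (true ∷ w) {suc p} (s≤s p<) letter≡ with posTrue-#true-take w p< letter≡
... | #< , pos≡ = s≤s #< , cong suc pos≡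
posTrue-#true-take (false ∷ w) {suc p} (s≤s p<) letter≡ with posTrue-#true-take w p< letter≡
... | #< , pos≡ = #< , cong suc pos≡

placeTrue : List Bool → ℕ → ℕ
placeTrue w m = 2 + posTrue w (m ∸ 1)

module PlaceTrue {w : List Bool} {m₀ : ℕ} {x : List ℕ} (x↭ : IsPerm m₀ x) (#true≡ : #true w ≡ m₀) where

  x′ : List ℕ
  x′ = map (placeTrue w) x

  pred< : ∀ {a} → a ∈ x → a ∸ 1 < #true w
  pred< {zero} a∈ with () ← proj₁ (IsPerm-∈⁻ x↭ a∈)
  pred< {suc a} a∈ = subst (a <_) (sym #true≡) (proj₂ (IsPerm-∈⁻ x↭ a∈))

  placeTrue-<⇔ : ∀ {a b} → a ∈ x → b ∈ x → (placeTrue w a < placeTrue w b ⇔ a < b)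
  placeTrue-<⇔ {zero} a∈ _ with () ← proj₁ (IsPerm-∈⁻ x↭ a∈)
  placeTrue-<⇔ {suc a} {zero} _ b∈ with () ← proj₁ (IsPerm-∈⁻ x↭ b∈)
  placeTrue-<⇔ {suc a} {suc b} a∈ b∈ =
    mk⇔ (λ place< → s≤s (Equivalence.to pos⇔ (≤-pred (≤-pred place<))))
        (λ { (s≤s a<b) → s≤s (s≤s (Equivalence.from pos⇔ a<b)) })
    where pos⇔ = posTrue-<⇔ w (pred< a∈) (pred< b∈)

  x′∼x : x′ ∼ x
  x′∼x = length-map (placeTrue w) x , λ a b a< b< →
    let a<x = subst (a <_) (length-map (placeTrue w) x) a<
        b<x = subst (b <_) (length-map (placeTrue w) x) b< in
    subst₂ (λ u v → (u < v) ⇔ (at x a < at x b)) (sym (at-map (placeTrue w) x a<x)) (sym (at-map (placeTrue w) x b<x))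
           (placeTrue-<⇔ (at-∈ x a<x) (at-∈ x b<x))

  x′-unique : Unique x′
  x′-unique = Unique-map⁺-on (placeTrue w) (IsPerm-unique x↭) injective
    where
    injective : ∀ {a b} → a ∈ x → b ∈ x → placeTrue w a ≡ placeTrue w b → a ≡ b
    injective {zero} a∈ _ _ with () ← proj₁ (IsPerm-∈⁻ x↭ a∈)
    injective {suc a} {zero} _ b∈ _ with () ← proj₁ (IsPerm-∈⁻ x↭ b∈)
    injective {suc a} {suc b} a∈ b∈ place≡ =
      cong suc (posTrue-injective w (pred< a∈) (pred< b∈) (suc-injective (suc-injective place≡)))

  ∈x′⁻ : ∀ {z} → z ∈ x′ → ∃[ p ] z ≡ 2 + p × p < length w × letter w p ≡ true
  ∈x′⁻ z∈ with ∈-map⁻ (placeTrue w) z∈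
  ... | a , a∈ , refl = posTrue w (a ∸ 1) , refl , posTrue-< w (pred< a∈) , letter-posTrue w (pred< a∈)

  ∈x′⁺ : ∀ {p} → p < length w → letter w p ≡ true → 2 + p ∈ x′
  ∈x′⁺ {p} p< letter≡ with posTrue-#true-take w p< letter≡
  ... | #< , pos≡ = subst (_∈ x′) (cong (2 +_) pos≡)
                          (∈-map⁺ (placeTrue w) (IsPerm-∈⁺ x↭ (s≤s z≤n) (subst (_ <_) #true≡ #<)))

module Construct {j k : ℕ} {σ τ : List ℕ} (w : List Bool) (σ↭ : IsPerm j σ) (τ↭ : IsPerm k τ)
                 (#true≡ : #true w ≡ j) (#false≡ : #false w ≡ k) where

  module Lower = PlaceTrue {w} σ↭ #true≡
  module Upper = PlaceTrue {map not w} τ↭ (trans (#true-map-not w) #false≡)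

  σ′ τ′ μ : List ℕ
  σ′ = Lower.x′
  τ′ = Upper.x′
  μ = σ′ ++ 1 ∷ τ′

  length-w : length w ≡ j + k
  length-w = trans (sym (#true+#false≡length w)) (cong₂ _+_ #true≡ #false≡)

  ∈τ′⁻ : ∀ {z} → z ∈ τ′ → ∃[ p ] z ≡ 2 + p × p < length w × letter w p ≡ false
  ∈τ′⁻ z∈ with Upper.∈x′⁻ z∈
  ... | p , z≡ , p< , letter≡ = p , z≡ , p<w , not-injective (trans (sym (letter-map-not w p<w)) letter≡)
    where p<w = subst (p <_) (length-map not w) p<

  ∈τ′⁺ : ∀ {p} → p < length w → letter w p ≡ false → 2 + p ∈ τ′
  ∈τ′⁺ {p} p< letter≡ = Upper.∈x′⁺ (subst (p <_) (sym (length-map not w)) p<)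
                                   (trans (letter-map-not w p<) (cong not letter≡))

  σ′∩τ′ : ∀ {z} → z ∈ σ′ → z ∉ τ′
  σ′∩τ′ z∈σ′ z∈τ′ with Lower.∈x′⁻ z∈σ′ | ∈τ′⁻ z∈τ′
  ... | p , refl , _ , true≡ | .p , refl , _ , false≡ with () ← trans (sym true≡) false≡

  1∉τ′ : 1 ∉ τ′
  1∉τ′ 1∈ with ∈τ′⁻ 1∈
  ... | p , () , _

  μ-unique : Unique μ
  μ-unique = Unique.++⁺ Lower.x′-unique (1≢τ′ ∷ Upper.x′-unique) disjoint
    where
    1≢τ′ : All (1 ≢_) τ′
    1≢τ′ = All.tabulate λ z∈ 1≡z → 1∉τ′ (subst (_∈ τ′) (sym 1≡z) z∈)
    disjoint : ∀ {z} → z ∈ σ′ × z ∈ 1 ∷ τ′ → ⊥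
    disjoint (z∈σ′ , here refl) with Lower.∈x′⁻ z∈σ′
    ... | p , () , _
    disjoint (z∈σ′ , there z∈τ′) = σ′∩τ′ z∈σ′ z∈τ′

  μ↭ : IsPerm (j + k + 1) μ
  μ↭ = IsPerm-intro μ-unique λ z → mk⇔ to (from z)
    where
    n≡ : j + k + 1 ≡ suc (j + k)
    n≡ = +-comm (j + k) 1
    bounded : ∀ {p} → p < length w → 1 ≤ 2 + p × 2 + p ≤ j + k + 1
    bounded {p} p< = s≤s z≤n , subst (2 + p ≤_) (sym n≡) (s≤s (subst (p <_) length-w p<))
    to : ∀ {z} → z ∈ μ → 1 ≤ z × z ≤ j + k + 1
    to z∈ with ∈-++⁻ σ′ z∈
    ... | inj₁ z∈σ′ with Lower.∈x′⁻ z∈σ′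
    ...   | p , refl , p< , _ = bounded p<
    to z∈ | inj₂ (here refl) = ≤-refl , subst (1 ≤_) (sym n≡) (s≤s z≤n)
    to z∈ | inj₂ (there z∈τ′) with ∈τ′⁻ z∈τ′
    ...   | p , refl , p< , _ = bounded p<
    from : ∀ z → 1 ≤ z × z ≤ j + k + 1 → z ∈ μ
    from (suc zero) _ = ∈-++⁺ʳ σ′ (here refl)
    from (suc (suc p)) (_ , z≤) with letter w p in letter≡
    ... | true = ∈-++⁺ˡ (Lower.∈x′⁺ p< letter≡)
      where p< = subst (p <_) (sym length-w) (≤-pred (subst (suc (suc p) ≤_) n≡ z≤))
    ... | false = ∈-++⁺ʳ σ′ (there (∈τ′⁺ p< letter≡))
      where p< = subst (p <_) (sym length-w) (≤-pred (subst (suc (suc p) ≤_) n≡ z≤))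

  open Split σ↭ τ↭ μ↭ Lower.x′∼x Upper.x′∼x public using (c-σ′; c-τ′)

  colours-μ : colours (j + k) μ ≡ w
  colours-μ = trans (cong (λ m → colours m μ) (sym length-w)) (map-interval-letter (leftOfOne μ) 2 w colour≡)
    where
    colour≡ : ∀ p → p < length w → leftOfOne μ (2 + p) ≡ letter w p
    colour≡ p p< with letter w p in letter≡
    ... | true = c-σ′ (Lower.∈x′⁺ p< letter≡)
    ... | false = c-τ′ (∈τ′⁺ p< letter≡)

map-≡⇒≗-∈ : {A B : Set} (f g : A → B) (xs : List A) → map f xs ≡ map g xs → ∀ {x} → x ∈ xs → f x ≡ g x
map-≡⇒≗-∈ f g (y ∷ xs) map≡ (here refl) = ∷-injectiveˡ map≡
map-≡⇒≗-∈ f g (y ∷ xs) map≡ (there x∈) = map-≡⇒≗-∈ f g xs (∷-injectiveʳ map≡) x∈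

inverse-injective : ∀ {n μ₁ μ₂} → IsPerm n μ₁ → IsPerm n μ₂ → inverse μ₁ ≡ inverse μ₂ → μ₁ ≡ μ₂
inverse-injective {n} {μ₁} {μ₂} μ₁↭ μ₂↭ inverse≡ =
  at-ext μ₁ μ₂ (trans (IsPerm-length μ₁↭) (sym (IsPerm-length μ₂↭))) at≡
  where
  position≡ : ∀ {v} → v ∈ interval 1 n → suc (indexOf v μ₁) ≡ suc (indexOf v μ₂)
  position≡ = map-≡⇒≗-∈ _ _ (interval 1 n)
    (trans (sym (inverse≡map-interval μ₁↭)) (trans inverse≡ (inverse≡map-interval μ₂↭)))
  at≡ : ∀ p → p < length μ₁ → at μ₁ p ≡ at μ₂ p
  at≡ p p< = sym (begin
    at μ₂ p               ≡⟨ cong (at μ₂) (indexOf-at μ₁ (IsPerm-unique μ₁↭) p<) ⟨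
    at μ₂ (indexOf v μ₁)  ≡⟨ cong (at μ₂) (suc-injective (position≡ (∈-interval⁺ 1≤v (s≤s v≤n)))) ⟩
    at μ₂ (indexOf v μ₂)  ≡⟨ at-indexOf μ₂ (IsPerm-∈⁺ μ₂↭ 1≤v v≤n) ⟩
    v                     ∎)
    where
    open ≡-Reasoning
    v = at μ₁ p
    1≤v = proj₁ (IsPerm-∈⁻ μ₁↭ (at-∈ μ₁ p<))
    v≤n = proj₂ (IsPerm-∈⁻ μ₁↭ (at-∈ μ₁ p<))

-- Sums over σ △ τ and σ ▽ τ

-- σ △ τ and σ ▽ τ are the cases e = j + k + 1 and e = 2.
InSplit : ℕ → ℕ → List ℕ → List ℕ → ℕ → List ℕ → Set
InSplit j k σ τ e μ =
  IsPerm (j + k + 1) μ × ∃[ σ′ ] ∃[ τ′ ] ((μ ≡ σ′ ++ [ 1 ] ++ τ′) × (σ′ ∼ σ) × (τ′ ∼ τ) × (e ∈ τ′))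

ColoursDecide : ℕ → ℕ → List ℕ → List ℕ → ℕ → (List Bool → Set) → Set
ColoursDecide j k σ τ e P = ∀ {σ′ τ′} → IsPerm (j + k + 1) (σ′ ++ 1 ∷ τ′) → σ′ ∼ σ → τ′ ∼ τ →
                            (P (colours (j + k) (σ′ ++ 1 ∷ τ′)) ⇔ e ∈ τ′)

module _ {j k σ τ e} {P : List Bool → Set} (P? : Decidable P) (σ↭ : IsPerm j σ) (τ↭ : IsPerm k τ)
         (decide : ColoursDecide j k σ τ e P) {L : List (List ℕ)} (L⇔ : ∀ μ → μ ∈ L ⇔ InSplit j k σ τ e μ) where

  colours-injective : ∀ {μ₁ μ₂} → μ₁ ∈ L → μ₂ ∈ L → colours (j + k) μ₁ ≡ colours (j + k) μ₂ → μ₁ ≡ μ₂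
  colours-injective {μ₁} {μ₂} μ₁∈ μ₂∈ colours≡ with Equivalence.to (L⇔ μ₁) μ₁∈ | Equivalence.to (L⇔ μ₂) μ₂∈
  ... | μ₁↭ , _ , _ , refl , σ₁∼σ , τ₁∼τ , _ | μ₂↭ , _ , _ , refl , σ₂∼σ , τ₂∼τ , _ =
    inverse-injective μ₁↭ μ₂↭ (begin
      inverse μ₁                                                                 ≡⟨ Split.inverse-μ σ↭ τ↭ μ₁↭ σ₁∼σ τ₁∼τ ⟩
      suc j ∷ merge (colours (j + k) μ₁) (inverse σ) (map (suc j +_) (inverse τ)) ≡⟨ cong (λ w → suc j ∷ merge w _ _) colours≡ ⟩
      suc j ∷ merge (colours (j + k) μ₂) (inverse σ) (map (suc j +_) (inverse τ)) ≡⟨ Split.inverse-μ σ↭ τ↭ μ₂↭ σ₂∼σ τ₂∼τ ⟨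
      inverse μ₂                                                                 ∎)
    where open ≡-Reasoning

  colours-↭ : Unique L → map (colours (j + k)) L ↭ filter P? (shuffles j k)
  colours-↭ uL = unique∧set⇒↭ (Unique-map⁺-on (colours (j + k)) uL colours-injective)
                              (Unique.filter⁺ P? (shuffles-unique j k)) same-members
    where
    to : ∀ {w} → w ∈ map (colours (j + k)) L → w ∈ filter P? (shuffles j k)
    to w∈ with ∈-map⁻ (colours (j + k)) w∈
    ... | μ , μ∈ , refl with Equivalence.to (L⇔ μ) μ∈
    ...   | μ↭ , σ′ , τ′ , refl , σ′∼σ , τ′∼τ , e∈ =
      ∈-filter⁺ P? (∈-shuffles⁺ #true-colours #false-colours) (Equivalence.from (decide μ↭ σ′∼σ τ′∼τ) e∈)
      where open Split σ↭ τ↭ μ↭ σ′∼σ τ′∼τ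
    from : ∀ {w} → w ∈ filter P? (shuffles j k) → w ∈ map (colours (j + k)) L
    from {w} w∈ with ∈-filter⁻ P? w∈
    ... | w∈shuffles , Pw with ∈-shuffles⁻ w∈shuffles
    ...   | #true≡ , #false≡ = subst (_∈ map (colours (j + k)) L) colours-μ (∈-map⁺ (colours (j + k)) μ∈)
      where
      open Construct w σ↭ τ↭ #true≡ #false≡
      e∈ : e ∈ τ′
      e∈ = Equivalence.to (decide μ↭ Lower.x′∼x Upper.x′∼x) (subst P (sym colours-μ) Pw)
      μ∈ : μ ∈ L
      μ∈ = Equivalence.from (L⇔ μ) (μ↭ , σ′ , τ′ , refl , Lower.x′∼x , Upper.x′∼x , e∈)
    same-members : ∀ w → w ∈ map (colours (j + k)) L ⇔ w ∈ filter P? (shuffles j k)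
    same-members w = mk⇔ to from

  sum-ides≡desSum : ∀ t → Unique L → sum (map (λ μ → t ^ ides μ) L) ≡
    desSum t (filter P? (shuffles j k)) (false ∷ descents (inverse σ)) (false ∷ descents (inverse τ))
  sum-ides≡desSum t uL = trans (sum-map-cong-∈ L ides≡) (sum-map-∘-↭ (weight t _ _) (colours (j + k)) (colours-↭ uL))
    where
    ides≡ : ∀ {μ} → μ ∈ L →
            t ^ ides μ ≡ weight t (false ∷ descents (inverse σ)) (false ∷ descents (inverse τ)) (colours (j + k) μ)
    ides≡ μ∈ with Equivalence.to (L⇔ _) μ∈
    ... | μ↭ , σ′ , τ′ , refl , σ′∼σ , τ′∼τ , _ = cong (t ^_) (Split.ides-μ σ↭ τ↭ μ↭ σ′∼σ τ′∼τ)

lastOr-map-interval : ∀ (f : ℕ → Bool) d a m → lastOr d (map f (interval a (suc m))) ≡ f (a + m)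
lastOr-map-interval f d a zero = cong f (sym (+-identityʳ a))
lastOr-map-interval f d a (suc m) = trans (lastOr-map-interval f (f a) (suc a) m) (cong f (sym (+-suc a m)))

endsWithFalse-decides : ∀ {j k σ τ} → IsPerm j σ → IsPerm (suc k) τ →
                        ColoursDecide j (suc k) σ τ (j + suc k + 1) (λ w → lastOr true w ≡ false)
endsWithFalse-decides {j} {k} σ↭ τ↭ {σ′} {τ′} μ↭ σ′∼σ τ′∼τ =
  mk⇔ (λ last≡ → subst (_∈ τ′) v≡ (Equivalence.to (T-not-c⇔τ′ 2≤v v≤)
                                      (Equivalence.from T-not-≡ (trans (sym last-colour) last≡))))
      (λ n∈ → trans last-colour (c-τ′ (subst (_∈ τ′) (sym v≡) n∈)))
  where
  open Split σ↭ τ↭ μ↭ σ′∼σ τ′∼τ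
  v≡ : 2 + (j + k) ≡ j + suc k + 1
  v≡ = trans (cong suc (sym (+-suc j k))) (+-comm 1 (j + suc k))
  2≤v : 2 ≤ 2 + (j + k)
  2≤v = s≤s (s≤s z≤n)
  v≤ : 2 + (j + k) ≤ suc (j + suc k)
  v≤ = s≤s (≤-reflexive (sym (+-suc j k)))
  last-colour : lastOr true (colours (j + suc k) μ) ≡ c (2 + (j + k))
  last-colour = trans (cong (λ m → lastOr true (map c (interval 2 m))) (+-suc j k)) (lastOr-map-interval c true 2 (j + k))

startsWithFalse-decides : ∀ {j k σ τ} → IsPerm j σ → IsPerm (suc k) τ →
                          ColoursDecide j (suc k) σ τ 2 (λ w → head w ≡ just false)
startsWithFalse-decides {j} {k} σ↭ τ↭ {σ′} {τ′} μ↭ σ′∼σ τ′∼τ =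
  mk⇔ (λ head≡ → Equivalence.to (T-not-c⇔τ′ ≤-refl 2≤)
                    (Equivalence.from T-not-≡ (Maybe.just-injective (trans (sym first-colour) head≡))))
      (λ 2∈ → trans first-colour (cong just (c-τ′ 2∈)))
  where
  open Split σ↭ τ↭ μ↭ σ′∼σ τ′∼τ
  2≤ : 2 ≤ suc (j + suc k)
  2≤ = s≤s (subst (1 ≤_) (sym (+-suc j k)) (s≤s z≤n))
  first-colour : head (colours (j + suc k) μ) ≡ just (c 2)
  first-colour = cong (λ m → head (map c (interval 2 m))) (+-suc j k)

sum-map-empty : {A : Set} {xs : List A} (f : A → ℕ) → (∀ {x} → x ∉ xs) → sum (map f xs) ≡ 0
sum-map-empty {xs = []} f _ = refl
sum-map-empty {xs = x ∷ xs} f ∉xs = ⊥-elim (∉xs (here refl))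

InSplit-empty-upper : ∀ {j σ τ e μ} → IsPerm 0 τ → ¬ InSplit j 0 σ τ e μ
InSplit-empty-upper τ↭ (_ , _ , [] , _ , _ , _ , ())
InSplit-empty-upper τ↭ (_ , _ , _ ∷ _ , _ , _ , (ℓ , _) , _) with () ← trans ℓ (IsPerm-length τ↭)

length-descents-inverse : ∀ {m x} → IsPerm m x → length (descents (inverse x)) ≡ m ∸ 1
length-descents-inverse {m} {x} x↭ =
  trans (length-descents (inverse x)) (cong (_∸ 1) (trans (length-inverse x) (IsPerm-length x↭)))

corollary3p1 : (j k : ℕ) (σ σ̂ τ τ̂ : List ℕ) →
    IsPerm j σ → IsPerm j σ̂ → ides σ ≡ ides σ̂ →
    IsPerm k τ → IsPerm k τ̂ → ides τ ≡ ides τ̂ →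
    (L L̂ : List (List ℕ)) →
    Unique L → (∀ μ → (μ ∈ L) ⇔ InUp j k σ τ μ) →
    Unique L̂ → (∀ μ → (μ ∈ L̂) ⇔ InDown j k σ̂ τ̂ μ) →
    (t : ℕ) →
    sum (map (λ μ → t ^ ides μ) L) ≡ sum (map (λ μ → t ^ ides μ) L̂)
corollary3p1 j zero σ σ̂ τ τ̂ _ _ _ τ↭ τ̂↭ _ L L̂ _ L⇔ _ L̂⇔ t =
  trans (sum-map-empty _ (InSplit-empty-upper {σ = σ} τ↭ ∘ Equivalence.to (L⇔ _)))
        (sym (sum-map-empty _ (InSplit-empty-upper {σ = σ̂} τ̂↭ ∘ Equivalence.to (L̂⇔ _))))
corollary3p1 j (suc k) σ σ̂ τ τ̂ σ↭ σ̂↭ ides-σ τ↭ τ̂↭ ides-τ L L̂ uL L⇔ uL̂ L̂⇔ t = begin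
  sum (map (λ μ → t ^ ides μ) L)
    ≡⟨ sum-ides≡desSum endsWithFalse? σ↭ τ↭ (endsWithFalse-decides σ↭ τ↭) L⇔ t uL ⟩
  desSum t (filter endsWithFalse? (shuffles j (suc k))) (false ∷ descents (inverse σ)) (false ∷ descents (inverse τ))
    ≡⟨ desSum-endsWithFalse≡startsWithFalse t j k _ _ _ _
         (length-descents-inverse σ↭) (length-descents-inverse σ̂↭) (#true-descents-inverse σ σ̂ ides-σ)
         (length-descents-inverse τ↭) (length-descents-inverse τ̂↭) (#true-descents-inverse τ τ̂ ides-τ) ⟩
  desSum t (filter startsWithFalse? (shuffles j (suc k))) (false ∷ descents (inverse σ̂)) (false ∷ descents (inverse τ̂))
    ≡⟨ sum-ides≡desSum startsWithFalse? σ̂↭ τ̂↭ (startsWithFalse-decides σ̂↭ τ̂↭) L̂⇔ t uL̂ ⟨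
  sum (map (λ μ → t ^ ides μ) L̂)
    ∎
  where
  open ≡-Reasoning
  #true-descents-inverse : ∀ x y → ides x ≡ ides y → #true (descents (inverse x)) ≡ #true (descents (inverse y))
  #true-descents-inverse x y ides≡ = trans (#true-descents (inverse x)) (trans ides≡ (sym (#true-descents (inverse y))))
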